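{- Let $m\geq 2$ be even. For every non-crossing perfect matching $M$ on the $2m$ points, $w(M)\in\{ -(m-2),-(m-2)+1,\dots,m-3,m-2\}$. Moreover, for every integer $c$ in this set there is a non-crossing perfect matching $M$ with $w(M)=c$.
   Context: Let $n=2m$ points be equally spaced on a unit circle centered at the origin, labeled clockwise $1,\dots,n$. Consider non-crossing perfect matchings on these points (straight-line edges, pairwise non-crossing). Every matching edge $\{i,j\}$ has $j-i$ odd. The length $\ell(e)$ of an edge $e$ is the minimum over the two sides of $e$ of (number of points strictly on that side)$/2$. For an edge $e$ with endpoints $i,j$ named so that the origin lies to the right of the ray from $i$ to $j$, $\mathrm{sgn}(e)=+1$ if $i$ is odd and $-1$ if $i$ is even. The weight of a matching $M$ is $w(M)=\sum_{e\in M}\mathrm{sgn}(e)\,\ell(e)$. -}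

module Defs where

open import Data.Nat as ℕ using (ℕ; zero; suc; _∸_; _<_; _<ᵇ_; _⊓_; ⌊_/2⌋)
open import Data.Fin using (Fin; toℕ)
open import Data.List using (List; []; _∷_; foldr)
open import Data.Bool using (Bool; true; false; if_then_else_)
open import Data.Integer as ℤ using (ℤ; +_; -_)
open import Data.Product using (_×_)
open import Data.Sum using (_⊎_)
open import Relation.Binary.PropositionalEquality using (_≡_; _≢_)
open import Data.List.Base using (allFin)

-- Points are Fin n; point x : Fin n carries the label (toℕ x + 1),
-- labels increasing clockwise.

Between : ℕ → ℕ → ℕ → Set
Between x a b = (a < x × x < b) ⊎ (b < x × x < a)

-- Two chords {a,p a}, {b,p b} with disjoint endpoints cross iff
-- exactly one of b, p b lies strictly between a and p a.
record NCMatching (n : ℕ) : Set where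
  field
    partner     : Fin n → Fin n
    involutive  : ∀ x → partner (partner x) ≡ x
    noFixed     : ∀ x → partner x ≢ x
    nonCrossing : ∀ a b → Between (toℕ b) (toℕ a) (toℕ (partner a))
                        → Between (toℕ (partner b)) (toℕ a) (toℕ (partner a))

isEvenᵇ : ℕ → Bool
isEvenᵇ zero = true
isEvenᵇ (suc k) = if isEvenᵇ k then false else true

-- Signed length of the edge {i, j} (0-indexed positions, i < j) among
-- n = 2m points.
--  * length: min over the two sides of (#points strictly on that side)/2,
--    sides having j-i-1 and n-(j-i)-1 points.
--  * the origin lies to the right of the ray from s to t iff going clockwise
--    from s to t passes fewer than m steps, i.e. 2(t-s mod n) < n.  So the
--    starting endpoint is i if 2(j-i) < n, and j otherwise.
--  * sign +1 iff the starting endpoint has odd label, i.e. even 0-index.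
edgeLength : ℕ → ℕ → ℕ → ℕ
edgeLength n i j = ⌊ ((j ∸ i) ∸ 1) ⊓ ((n ∸ (j ∸ i)) ∸ 1) /2⌋

edgeSign : ℕ → ℕ → ℕ → Bool   -- true = +1
edgeSign n i j = isEvenᵇ (if (2 ℕ.* (j ∸ i)) <ᵇ n then i else j)

edgeWeight : ℕ → ℕ → ℕ → ℤ
edgeWeight n i j = if edgeSign n i j then + edgeLength n i j else - (+ edgeLength n i j)

-- w(M) = Σ over edges {x, partner x} (each counted once, via toℕ x < toℕ (partner x)).
weight : {n : ℕ} → NCMatching n → ℤ
weight {n} M = foldr ℤ._+_ (+ 0) (Data.List.Base.map f (allFin n))
  where
  open NCMatching M
  f : Fin n → ℤ
  f x = if toℕ x <ᵇ toℕ (partner x) then edgeWeight n (toℕ x) (toℕ (partner x)) else + 0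

module Submission where

-- Number the points 0, …, 2m − 1 and read a matching as an involution P. An edge {z, P z} with
-- z < P z has odd span P z − z = 2k + 1, because the points inside it are matched among themselves.
-- A short edge (2k + 1 < m) weighs ±k with the parity sign of z, a long one ∓(m − 1 − k). Doubling and
-- summing, the positions ±z cancel over all 2m points up to −m, which leaves
--   W = A − (m − 1)(Lₑ − Lₒ),
-- with A the number of odd left endpoints and Lₑ, Lₒ the numbers of even and odd left endpoints of long
-- edges. Left of a long left endpoint x, every point is matched left of x or starts an earlier long edge,
-- so the long left endpoints alternate in parity starting with an even one: Lₑ − Lₒ ∈ {0, 1}. If it is 0,
-- then W = A ≤ m − 2 since 0 and one further point are even left endpoints; if it is 1, some odd point is a
-- left endpoint and W = A − (m − 1) ≥ −(m − 2).
-- Conversely, adjacent pairs have weight 0, and an edge {0, L + 1} around a block followed by a second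
-- block (an edge around adjacent pairs, then adjacent pairs) realises every A from 1 to m − 2, with the
-- first edge short or long as needed.

open import Defs
open import Data.Nat using (ℕ; _≤_; _∸_)
open import Data.Nat.Divisibility using (_∣_)
open import Data.Integer as ℤ using (ℤ; +_; -_)
open import Data.Product using (_×_; ∃-syntax)
open import Relation.Binary.PropositionalEquality using (_≡_)

open import Algebra.Bundles using (CommutativeMonoid)
import Algebra.Structures
import Algebra.Properties.CommutativeSemigroup as CommutativeSemigroupProperties
import Algebra.Properties.CommutativeMonoid.Sum as CommutativeMonoidSum
open import Data.Bool using (Bool; true; false; if_then_else_; _∧_; not; T)
open import Data.Bool.Properties using (not-involutive; ∧-comm; ∧-identityʳ; ∧-zeroʳ)
open import Data.Empty using (⊥-elim)
open import Data.Fin using (Fin; toℕ; fromℕ<)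
import Data.Fin.Properties as Finₚ
import Data.Integer.Properties as ℤₚ
import Data.Integer.Tactic.RingSolver as ℤSolver
import Data.Nat.Tactic.RingSolver as ℕSolver
open import Data.Fin.Permutation using (permutation)
open import Data.List using (foldr; tabulate)
import Data.List.Properties as Listₚ
open import Data.Nat using (zero; suc; _+_; _*_; _<_; _<ᵇ_; _≡ᵇ_; _<?_; _⊓_; ⌊_/2⌋; z≤n; s≤s; z<s)
open import Data.Nat.Properties
open import Data.Nat.Divisibility using (divides)
open import Data.Product using (_,_; proj₁; proj₂; uncurry; map₁; map₂)
open import Data.Sum using (_⊎_; inj₁; inj₂)
open import Data.Unit using (tt)
open import Relation.Nullary using (yes; no)
open import Relation.Binary.Definitions using (tri<; tri≈; tri>)
open import Function using (_∘_; case_of_)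
open import Level using (0ℓ)
open import Relation.Binary.PropositionalEquality
  using (_≢_; refl; sym; trans; cong; cong₂; subst; subst₂; module ≡-Reasoning)

𝟙 : Bool → ℕ
𝟙 b = if b then 1 else 0

<⇒<ᵇ≡true : ∀ {a b} → a < b → (a <ᵇ b) ≡ true
<⇒<ᵇ≡true {a} {b} a<b with a <ᵇ b in eq
... | true = refl
... | false = ⊥-elim (subst T eq (<⇒<ᵇ a<b))

≥⇒<ᵇ≡false : ∀ {a b} → b ≤ a → (a <ᵇ b) ≡ false
≥⇒<ᵇ≡false {a} {b} b≤a with a <ᵇ b in eq
... | false = refl
... | true = ⊥-elim (≤⇒≯ b≤a (<ᵇ⇒< a b (subst T (sym eq) tt)))

<ᵇ≡true⇒< : ∀ {a b} → (a <ᵇ b) ≡ true → a < b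
<ᵇ≡true⇒< {a} {b} eq = <ᵇ⇒< a b (subst T (sym eq) tt)

<ᵇ≡false⇒≥ : ∀ {a b} → (a <ᵇ b) ≡ false → b ≤ a
<ᵇ≡false⇒≥ eq = ≮⇒≥ (λ a<b → subst T eq (<⇒<ᵇ a<b))

≡⇒≡ᵇ≡true : ∀ {a b} → a ≡ b → (a ≡ᵇ b) ≡ true
≡⇒≡ᵇ≡true {a} {b} a≡b with a ≡ᵇ b in eq
... | true = refl
... | false = ⊥-elim (subst T eq (≡⇒≡ᵇ a b a≡b))

≢⇒≡ᵇ≡false : ∀ {a b} → a ≢ b → (a ≡ᵇ b) ≡ false
≢⇒≡ᵇ≡false {a} {b} a≢b with a ≡ᵇ b in eq
... | false = refl
... | true = ⊥-elim (a≢b (≡ᵇ⇒≡ a b (subst T (sym eq) tt)))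

-- Sums over initial segments of ℕ

module RangeSum {A : Set} {_∙_ : A → A → A} {ε : A}
                (isCM : Algebra.Structures.IsCommutativeMonoid {A = A} _≡_ _∙_ ε) where

  open Algebra.Structures.IsCommutativeMonoid isCM using (assoc; identityˡ; identityʳ)

  monoid : CommutativeMonoid 0ℓ 0ℓ
  monoid = record { isCommutativeMonoid = isCM }

  open CommutativeSemigroupProperties (CommutativeMonoid.commutativeSemigroup monoid) using (interchange)
  open CommutativeMonoidSum monoid using (sum; sum-permute; sum-cong-≗)

  ∑ : ℕ → (ℕ → A) → A
  ∑ zero f = ε
  ∑ (suc k) f = ∑ k f ∙ f k

  ∑-cong : ∀ k {f g : ℕ → A} → (∀ z → z < k → f z ≡ g z) → ∑ k f ≡ ∑ k g
  ∑-cong zero f≗g = refl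
  ∑-cong (suc k) f≗g = cong₂ _∙_ (∑-cong k (λ z z<k → f≗g z (m<n⇒m<1+n z<k))) (f≗g k ≤-refl)

  ∑-distrib : ∀ k (f g : ℕ → A) → ∑ k (λ z → f z ∙ g z) ≡ ∑ k f ∙ ∑ k g
  ∑-distrib zero f g = sym (identityˡ ε)
  ∑-distrib (suc k) f g = trans (cong (_∙ (f k ∙ g k)) (∑-distrib k f g)) (interchange _ _ _ _)

  ∑-zero : ∀ k (f : ℕ → A) → (∀ z → z < k → f z ≡ ε) → ∑ k f ≡ ε
  ∑-zero k f f≗ε = trans (∑-cong k f≗ε) (∑-ε k)
    where
    ∑-ε : ∀ k → ∑ k (λ _ → ε) ≡ ε
    ∑-ε zero = refl
    ∑-ε (suc k) = trans (identityʳ _) (∑-ε k)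

  ∑-split : ∀ a b (f : ℕ → A) → ∑ (a + b) f ≡ ∑ a f ∙ ∑ b (λ i → f (a + i))
  ∑-split a zero f rewrite +-identityʳ a = sym (identityʳ (∑ a f))
  ∑-split a (suc b) f rewrite +-suc a b | ∑-split a b f = assoc (∑ a f) _ _

  ∑-extend : ∀ {k n} → k ≤ n → (f : ℕ → A) → (∀ z → k ≤ z → f z ≡ ε) → ∑ k f ≡ ∑ n f
  ∑-extend {k} {n} k≤n f f≡ε = begin
    ∑ k f                               ≡⟨ identityʳ (∑ k f) ⟨
    ∑ k f ∙ ε                           ≡⟨ cong (∑ k f ∙_) (∑-zero (n ∸ k) _ (λ i _ → f≡ε (k + i) (m≤m+n k i))) ⟨
    ∑ k f ∙ ∑ (n ∸ k) (λ i → f (k + i))  ≡⟨ ∑-split k (n ∸ k) f ⟨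
    ∑ (k + (n ∸ k)) f                   ≡⟨ cong (λ t → ∑ t f) (m+[n∸m]≡n k≤n) ⟩
    ∑ n f                               ∎
    where open ≡-Reasoning

  ∑-head : ∀ k (f : ℕ → A) → ∑ (suc k) f ≡ f 0 ∙ ∑ k (λ i → f (suc i))
  ∑-head k f = trans (∑-split 1 k f) (cong (_∙ ∑ k (λ i → f (suc i))) (identityˡ (f 0)))

  foldr-tabulate : ∀ n (f : ℕ → A) → foldr _∙_ ε (tabulate {n = n} (f ∘ toℕ)) ≡ ∑ n f
  foldr-tabulate zero f = refl
  foldr-tabulate (suc n) f = trans (cong (f 0 ∙_) (foldr-tabulate n (f ∘ suc))) (sym (∑-head n f))

  sum-toℕ : ∀ {k} (g : ℕ → A) → sum {k} (g ∘ toℕ) ≡ ∑ k g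
  sum-toℕ {zero} g = refl
  sum-toℕ {suc k} g = trans (cong (g 0 ∙_) (sum-toℕ {k} (g ∘ suc))) (sym (∑-head k g))

  ∑-involution : ∀ n (p : ℕ → ℕ) → (∀ z → z < n → p z < n) → (∀ z → z < n → p (p z) ≡ z) →
                 ∀ (f : ℕ → A) → ∑ n (f ∘ p) ≡ ∑ n f
  ∑-involution n p p<n p∘p f = begin
    ∑ n (f ∘ p)              ≡⟨ sum-toℕ {n} (f ∘ p) ⟨
    sum {n} (f ∘ p ∘ toℕ)    ≡⟨ sum-cong-≗ (cong f ∘ toℕ-π) ⟨
    sum {n} (f ∘ toℕ ∘ π)    ≡⟨ sum-permute (f ∘ toℕ) (permutation π π π∘π π∘π) ⟨
    sum {n} (f ∘ toℕ)        ≡⟨ sum-toℕ {n} f ⟩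
    ∑ n f                    ∎
    where
    open ≡-Reasoning
    π : Fin n → Fin n
    π x = fromℕ< (p<n (toℕ x) (Finₚ.toℕ<n x))
    toℕ-π : ∀ x → toℕ (π x) ≡ p (toℕ x)
    toℕ-π x = Finₚ.toℕ-fromℕ< (p<n (toℕ x) (Finₚ.toℕ<n x))
    π∘π : ∀ x → π (π x) ≡ x
    π∘π x = Finₚ.toℕ-injective (trans (toℕ-π (π x)) (trans (cong p (toℕ-π x)) (p∘p (toℕ x) (Finₚ.toℕ<n x))))

module RangeSumHom {A B : Set} {_∙_ : A → A → A} {ε : A} {_◦_ : B → B → B} {ε′ : B}
                   (isCM : Algebra.Structures.IsCommutativeMonoid {A = A} _≡_ _∙_ ε)
                   (isCM′ : Algebra.Structures.IsCommutativeMonoid {A = B} _≡_ _◦_ ε′) where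

  private
    module S = RangeSum isCM
    module S′ = RangeSum isCM′

  ∑-hom : (h : A → B) → h ε ≡ ε′ → (∀ x y → h (x ∙ y) ≡ h x ◦ h y) →
          ∀ k (f : ℕ → A) → h (S.∑ k f) ≡ S′.∑ k (h ∘ f)
  ∑-hom h h-ε h-∙ zero f = h-ε
  ∑-hom h h-ε h-∙ (suc k) f = trans (h-∙ (S.∑ k f) (f k)) (cong (_◦ h (f k)) (∑-hom h h-ε h-∙ k f))

module ℕΣ = RangeSum +-0-isCommutativeMonoid
module ℤΣ = RangeSum ℤₚ.+-0-isCommutativeMonoid

∑-pos : ∀ k (f : ℕ → ℕ) → + ℕΣ.∑ k f ≡ ℤΣ.∑ k (+_ ∘ f)
∑-pos = RangeSumHom.∑-hom +-0-isCommutativeMonoid ℤₚ.+-0-isCommutativeMonoid +_ refl ℤₚ.pos-+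

∑-neg : ∀ k (f : ℕ → ℤ) → - ℤΣ.∑ k f ≡ ℤΣ.∑ k (-_ ∘ f)
∑-neg = RangeSumHom.∑-hom ℤₚ.+-0-isCommutativeMonoid ℤₚ.+-0-isCommutativeMonoid -_ refl ℤₚ.neg-distrib-+

∑-scale : ∀ c k (f : ℕ → ℤ) → c ℤ.* ℤΣ.∑ k f ≡ ℤΣ.∑ k (λ z → c ℤ.* f z)
∑-scale c = RangeSumHom.∑-hom ℤₚ.+-0-isCommutativeMonoid ℤₚ.+-0-isCommutativeMonoid (c ℤ.*_) (ℤₚ.*-zeroʳ c) (ℤₚ.*-distribˡ-+ c)

∑-ones : ∀ k → ℕΣ.∑ k (λ _ → 1) ≡ k
∑-ones zero = refl
∑-ones (suc k) = trans (cong (_+ 1) (∑-ones k)) (+-comm k 1)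

term≤∑ : ∀ k (f : ℕ → ℕ) z → z < k → f z ≤ ℕΣ.∑ k f
term≤∑ (suc k) f z z<1+k with m<1+n⇒m<n∨m≡n z<1+k
... | inj₁ z<k = ≤-trans (term≤∑ k f z z<k) (m≤m+n _ _)
... | inj₂ refl = m≤n+m _ _

∑-positive : ∀ k (f : ℕ → ℕ) → 0 < ℕΣ.∑ k f → ∃[ z ] (z < k × 0 < f z)
∑-positive (suc k) f 0<∑ with f k in eq
... | suc _ = k , ≤-refl , subst (0 <_) (sym eq) z<s
... | zero with ∑-positive k f (subst (0 <_) (+-identityʳ _) 0<∑)
...   | z , z<k , 0<fz = z , m<n⇒m<1+n z<k , 0<fz

two≤∑ : ∀ n (f : ℕ → ℕ) y → 0 < y → y < n → f 0 ≡ 1 → f y ≡ 1 → 2 ≤ ℕΣ.∑ n f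
two≤∑ (suc n) f (suc y) _ (s≤s y<n) f0≡1 fy≡1 = begin
  1 + 1                        ≤⟨ +-mono-≤ (≤-reflexive (sym f0≡1)) (≤-trans (≤-reflexive (sym fy≡1)) (term≤∑ n (f ∘ suc) y y<n)) ⟩
  f 0 + ℕΣ.∑ n (f ∘ suc)       ≡⟨ ℕΣ.∑-head n f ⟨
  ℕΣ.∑ (suc n) f               ∎
  where open ≤-Reasoning

∑-only-head : ∀ n (f : ℕ → ℕ) → 0 < n → (∀ z → 0 < z → z < n → f z ≡ 0) → ℕΣ.∑ n f ≡ f 0
∑-only-head (suc n) f _ f≡0 = begin
  ℕΣ.∑ (suc n) f             ≡⟨ ℕΣ.∑-head n f ⟩
  f 0 + ℕΣ.∑ n (f ∘ suc)     ≡⟨ cong (_+_ (f 0)) (ℕΣ.∑-zero n (f ∘ suc) (λ i i<n → f≡0 (suc i) z<s (s≤s i<n))) ⟩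
  f 0 + 0                    ≡⟨ +-identityʳ (f 0) ⟩
  f 0                        ∎
  where open ≡-Reasoning

∑-below-⊓ : ∀ n b → ℕΣ.∑ n (λ y → 𝟙 (y <ᵇ b)) ≡ n ⊓ b
∑-below-⊓ zero b = refl
∑-below-⊓ (suc n) b with n <? b
... | yes n<b rewrite ∑-below-⊓ n b | <⇒<ᵇ≡true n<b | m≤n⇒m⊓n≡m (<⇒≤ n<b) | m≤n⇒m⊓n≡m n<b = +-comm n 1
... | no n≮b rewrite ∑-below-⊓ n b | ≥⇒<ᵇ≡false (≮⇒≥ n≮b) | m≥n⇒m⊓n≡n (≮⇒≥ n≮b)
                   | m≥n⇒m⊓n≡n (m≤n⇒m≤1+n (≮⇒≥ n≮b)) = +-identityʳ b

∑-below : ∀ n b → b ≤ n → ℕΣ.∑ n (λ y → 𝟙 (y <ᵇ b)) ≡ b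
∑-below n b b≤n = trans (∑-below-⊓ n b) (m≥n⇒m⊓n≡n b≤n)

∑-between : ∀ n a b → a < b → b ≤ n → ℕΣ.∑ n (λ y → 𝟙 ((a <ᵇ y) ∧ (y <ᵇ b))) ≡ b ∸ suc a
∑-between n a b a<b b≤n = begin
  ℕΣ.∑ n between                                ≡⟨ m+n∸n≡m _ (suc a) ⟨
  ℕΣ.∑ n between + suc a ∸ suc a                ≡⟨ cong (λ t → ℕΣ.∑ n between + t ∸ suc a) (∑-below n (suc a) (<-≤-trans a<b b≤n)) ⟨
  ℕΣ.∑ n between + ℕΣ.∑ n atMost ∸ suc a        ≡⟨ cong (_∸ suc a) (ℕΣ.∑-distrib n between atMost) ⟨
  ℕΣ.∑ n (λ y → between y + atMost y) ∸ suc a   ≡⟨ cong (_∸ suc a) (ℕΣ.∑-cong n (λ y _ → between+atMost y)) ⟩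
  ℕΣ.∑ n (λ y → 𝟙 (y <ᵇ b)) ∸ suc a             ≡⟨ cong (_∸ suc a) (∑-below n b b≤n) ⟩
  b ∸ suc a                                     ∎
  where
  open ≡-Reasoning
  between atMost : ℕ → ℕ
  between y = 𝟙 ((a <ᵇ y) ∧ (y <ᵇ b))
  atMost y = 𝟙 (y <ᵇ suc a)
  between+atMost : ∀ y → between y + atMost y ≡ 𝟙 (y <ᵇ b)
  between+atMost y with a <? y
  ... | yes a<y rewrite <⇒<ᵇ≡true a<y | ≥⇒<ᵇ≡false {y} {suc a} a<y = +-identityʳ _
  ... | no a≮y rewrite ≥⇒<ᵇ≡false (≮⇒≥ a≮y) | <⇒<ᵇ≡true (s≤s (≮⇒≥ a≮y)) | <⇒<ᵇ≡true (≤-<-trans (≮⇒≥ a≮y) a<b) = refl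

isEvenᵇ-suc : ∀ k → isEvenᵇ (suc k) ≡ not (isEvenᵇ k)
isEvenᵇ-suc k with isEvenᵇ k
... | true = refl
... | false = refl

isEvenᵇ-+-double : ∀ k r → isEvenᵇ (k + k + r) ≡ isEvenᵇ r
isEvenᵇ-+-double zero r = refl
isEvenᵇ-+-double (suc k) r rewrite +-suc k k | isEvenᵇ-suc (suc (k + k + r)) | isEvenᵇ-suc (k + k + r)
  | isEvenᵇ-+-double k r = not-involutive (isEvenᵇ r)

isEvenᵇ-double : ∀ k → isEvenᵇ (k + k) ≡ true
isEvenᵇ-double k = trans (cong isEvenᵇ (sym (+-identityʳ (k + k)))) (isEvenᵇ-+-double k 0)

isEvenᵇ-+-odd : ∀ z k → isEvenᵇ (z + suc (k + k)) ≡ not (isEvenᵇ z)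
isEvenᵇ-+-odd z k rewrite +-comm z (suc (k + k)) | isEvenᵇ-suc (k + k + z) = cong not (isEvenᵇ-+-double k z)

odd≢double : ∀ k h → suc (k + k) ≢ h + h
odd≢double k h eq = case trans (sym (isEvenᵇ-double h)) (trans (cong isEvenᵇ (sym eq)) isEvenᵇ-odd) of λ ()
  where
  isEvenᵇ-odd : isEvenᵇ (suc (k + k)) ≡ false
  isEvenᵇ-odd = trans (isEvenᵇ-suc (k + k)) (cong not (isEvenᵇ-double k))

Between-< : ∀ {x y b} → x < y → Between b x y → x < b × b < y
Between-< x<y (inj₁ x<b<y) = x<b<y
Between-< x<y (inj₂ (y<b , b<x)) = ⊥-elim (<-asym x<y (<-trans y<b b<x))

Between-lower : ∀ {lo a w b} → lo ≤ a → lo ≤ w → Between b a w → lo ≤ b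
Between-lower lo≤a lo≤w (inj₁ (a<b , _)) = ≤-trans lo≤a (<⇒≤ a<b)
Between-lower lo≤a lo≤w (inj₂ (w<b , _)) = ≤-trans lo≤w (<⇒≤ w<b)

Between-upper : ∀ {hi a w b} → a < hi → w < hi → Between b a w → b < hi
Between-upper a<hi w<hi (inj₁ (_ , b<w)) = <-trans b<w w<hi
Between-upper a<hi w<hi (inj₂ (_ , b<a)) = <-trans b<a a<hi

Between-+ˡ : ∀ s {b a w} → Between b a w → Between (s + b) (s + a) (s + w)
Between-+ˡ s (inj₁ (a<b , b<w)) = inj₁ (+-monoʳ-< s a<b , +-monoʳ-< s b<w)
Between-+ˡ s (inj₂ (w<b , b<a)) = inj₂ (+-monoʳ-< s w<b , +-monoʳ-< s b<a)

Between-+ˡ⁻¹ : ∀ s {b a w} → Between (s + b) (s + a) (s + w) → Between b a w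
Between-+ˡ⁻¹ s (inj₁ (a<b , b<w)) = inj₁ (+-cancelˡ-< s _ _ a<b , +-cancelˡ-< s _ _ b<w)
Between-+ˡ⁻¹ s (inj₂ (w<b , b<a)) = inj₂ (+-cancelˡ-< s _ _ w<b , +-cancelˡ-< s _ _ b<a)

-- Non-crossing matchings of an interval

record IsMatchingOn (f : ℕ → ℕ) (lo hi : ℕ) : Set where
  field
    range       : ∀ z → lo ≤ z → z < hi → lo ≤ f z × f z < hi
    involutive  : ∀ z → lo ≤ z → z < hi → f (f z) ≡ z
    noFixed     : ∀ z → lo ≤ z → z < hi → f z ≢ z
    nonCrossing : ∀ a b → lo ≤ a → a < hi → Between b a (f a) → Between (f b) a (f a)

leftEdgeWeight : ℕ → (ℕ → ℕ) → ℕ → ℤ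
leftEdgeWeight n f z = if z <ᵇ f z then edgeWeight n z (f z) else + 0

weight≡∑ : ∀ {n} (M : NCMatching n) (f : ℕ → ℕ) → (∀ x → toℕ (NCMatching.partner M x) ≡ f (toℕ x)) →
           weight M ≡ ℤΣ.∑ n (leftEdgeWeight n f)
weight≡∑ {n} M f partner≗f = trans (cong (foldr ℤ._+_ (+ 0)) (trans (Listₚ.map-tabulate (λ x → x) _)
    (Listₚ.tabulate-cong (λ x → cong (λ t → if toℕ x <ᵇ t then edgeWeight n (toℕ x) t else + 0) (partner≗f x)))))
  (ℤΣ.foldr-tabulate n (leftEdgeWeight n f))

module _ {n} {f : ℕ → ℕ} (M : IsMatchingOn f 0 n) where
  open IsMatchingOn M

  private
    π : Fin n → Fin n
    π x = fromℕ< (proj₂ (range (toℕ x) z≤n (Finₚ.toℕ<n x)))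

    toℕ-π : ∀ x → toℕ (π x) ≡ f (toℕ x)
    toℕ-π x = Finₚ.toℕ-fromℕ< (proj₂ (range (toℕ x) z≤n (Finₚ.toℕ<n x)))

  toNCMatching : NCMatching n
  toNCMatching = record
    { partner = π
    ; involutive = λ x → Finₚ.toℕ-injective (trans (toℕ-π (π x)) (trans (cong f (toℕ-π x)) (involutive (toℕ x) z≤n (Finₚ.toℕ<n x))))
    ; noFixed = λ x πx≡x → noFixed (toℕ x) z≤n (Finₚ.toℕ<n x) (trans (sym (toℕ-π x)) (cong toℕ πx≡x))
    ; nonCrossing = λ a b between → subst₂ (λ u v → Between u (toℕ a) v) (sym (toℕ-π b)) (sym (toℕ-π a))
        (nonCrossing (toℕ a) (toℕ b) z≤n (Finₚ.toℕ<n a) (subst (Between (toℕ b) (toℕ a)) (toℕ-π a) between))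
    }

  weight-toNCMatching : weight toNCMatching ≡ ℤΣ.∑ n (leftEdgeWeight n f)
  weight-toNCMatching = weight≡∑ toNCMatching f toℕ-π

module _ {n} (M : NCMatching n) where
  open NCMatching M

  partnerℕ : ℕ → ℕ
  partnerℕ z with z <? n
  ... | yes z<n = toℕ (partner (fromℕ< z<n))
  ... | no _ = z

  private
    partnerℕ-fromℕ< : ∀ {z} (z<n : z < n) → partnerℕ z ≡ toℕ (partner (fromℕ< z<n))
    partnerℕ-fromℕ< {z} z<n with z <? n
    ... | yes _ = refl
    ... | no z≮n = ⊥-elim (z≮n z<n)

    partnerℕ-toℕ : ∀ x → partnerℕ (toℕ x) ≡ toℕ (partner x)
    partnerℕ-toℕ x = trans (partnerℕ-fromℕ< (Finₚ.toℕ<n x)) (cong (toℕ ∘ partner) (Finₚ.fromℕ<-toℕ x (Finₚ.toℕ<n x)))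

    partnerℕ<n : ∀ z → z < n → partnerℕ z < n
    partnerℕ<n z z<n = subst (_< n) (sym (partnerℕ-fromℕ< z<n)) (Finₚ.toℕ<n _)

  isMatchingOn-partnerℕ : IsMatchingOn partnerℕ 0 n
  isMatchingOn-partnerℕ = record
    { range = λ z _ z<n → z≤n , partnerℕ<n z z<n
    ; involutive = λ z _ z<n → trans (cong partnerℕ (partnerℕ-fromℕ< z<n))
        (trans (partnerℕ-toℕ (partner (fromℕ< z<n))) (trans (cong toℕ (involutive _)) (Finₚ.toℕ-fromℕ< z<n)))
    ; noFixed = λ z _ z<n eq → noFixed (fromℕ< z<n)
        (Finₚ.toℕ-injective (trans (sym (partnerℕ-fromℕ< z<n)) (trans eq (sym (Finₚ.toℕ-fromℕ< z<n)))))
    ; nonCrossing = nonCrossingℕ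
    }
    where
    nonCrossingℕ : ∀ a b → 0 ≤ a → a < n → Between b a (partnerℕ a) → Between (partnerℕ b) a (partnerℕ a)
    nonCrossingℕ a b _ a<n between
      with b<n ← Between-upper a<n (partnerℕ<n a a<n) between
      rewrite partnerℕ-fromℕ< a<n | partnerℕ-fromℕ< b<n
      = subst (λ u → Between (toℕ (partner (fromℕ< b<n))) u (toℕ (partner (fromℕ< a<n))))
          (Finₚ.toℕ-fromℕ< a<n)
          (nonCrossing (fromℕ< a<n) (fromℕ< b<n)
            (subst₂ (λ u v → Between u v (toℕ (partner (fromℕ< a<n)))) (sym (Finₚ.toℕ-fromℕ< b<n)) (sym (Finₚ.toℕ-fromℕ< a<n)) between))

  weight-partnerℕ : weight M ≡ ℤΣ.∑ n (leftEdgeWeight n partnerℕ)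
  weight-partnerℕ = weight≡∑ M partnerℕ (sym ∘ partnerℕ-toℕ)

[_]·_ : Bool → ℤ → ℤ
[ b ]· x = if b then x else + 0

module Structure {n} {P : ℕ → ℕ} (M : IsMatchingOn P 0 n) where
  open IsMatchingOn M

  P<n : ∀ z → z < n → P z < n
  P<n z z<n = proj₂ (range z z≤n z<n)

  P∘P : ∀ z → z < n → P (P z) ≡ z
  P∘P z z<n = involutive z z≤n z<n

  P≢id : ∀ z → z < n → P z ≢ z
  P≢id z z<n = noFixed z z≤n z<n

  isLeft : ℕ → Bool
  isLeft z = z <ᵇ P z

  𝟙-split : ∀ (Q : ℕ → Bool) z → z < n → 𝟙 (Q z) ≡ 𝟙 (Q z ∧ isLeft z) + 𝟙 (Q z ∧ (P z <ᵇ z))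
  𝟙-split Q z z<n with Q z | <-cmp z (P z)
  ... | false | _ = refl
  ... | true | tri< z<Pz _ _ rewrite <⇒<ᵇ≡true z<Pz | ≥⇒<ᵇ≡false (<⇒≤ z<Pz) = refl
  ... | true | tri≈ _ z≡Pz _ = ⊥-elim (P≢id z z<n (sym z≡Pz))
  ... | true | tri> _ _ Pz<z rewrite <⇒<ᵇ≡true Pz<z | ≥⇒<ᵇ≡false (<⇒≤ Pz<z) = refl

  count-invariant : ∀ (Q : ℕ → Bool) → (∀ z → z < n → Q (P z) ≡ Q z) →
    ℕΣ.∑ n (𝟙 ∘ Q) ≡ ℕΣ.∑ n (λ z → 𝟙 (Q z ∧ isLeft z)) + ℕΣ.∑ n (λ z → 𝟙 (Q z ∧ isLeft z))
  count-invariant Q Q∘P≗Q = begin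
    ℕΣ.∑ n (𝟙 ∘ Q)                                              ≡⟨ ℕΣ.∑-cong n (𝟙-split Q) ⟩
    ℕΣ.∑ n (λ z → leftIn z + 𝟙 (Q z ∧ (P z <ᵇ z)))              ≡⟨ ℕΣ.∑-distrib n leftIn _ ⟩
    ℕΣ.∑ n leftIn + ℕΣ.∑ n (λ z → 𝟙 (Q z ∧ (P z <ᵇ z)))         ≡⟨ cong (_+_ (ℕΣ.∑ n leftIn)) (ℕΣ.∑-cong n rightIn≡leftIn∘P) ⟩
    ℕΣ.∑ n leftIn + ℕΣ.∑ n (leftIn ∘ P)                          ≡⟨ cong (_+_ (ℕΣ.∑ n leftIn)) (ℕΣ.∑-involution n P P<n P∘P leftIn) ⟩
    ℕΣ.∑ n leftIn + ℕΣ.∑ n leftIn                                ∎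
    where
    open ≡-Reasoning
    leftIn : ℕ → ℕ
    leftIn z = 𝟙 (Q z ∧ isLeft z)
    rightIn≡leftIn∘P : ∀ z → z < n → 𝟙 (Q z ∧ (P z <ᵇ z)) ≡ leftIn (P z)
    rightIn≡leftIn∘P z z<n rewrite Q∘P≗Q z z<n | P∘P z z<n = refl

  ∑-edges : ∀ (g : ℕ → ℤ) → ℤΣ.∑ n (λ z → [ isLeft z ]· (g z ℤ.+ g (P z))) ≡ ℤΣ.∑ n g
  ∑-edges g = begin
    ℤΣ.∑ n (λ z → [ isLeft z ]· (g z ℤ.+ g (P z)))                ≡⟨ ℤΣ.∑-cong n (λ z _ → distrib (isLeft z)) ⟩
    ℤΣ.∑ n (λ z → [ isLeft z ]· g z ℤ.+ [ isLeft z ]· g (P z))    ≡⟨ ℤΣ.∑-distrib n _ _ ⟩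
    ℤΣ.∑ n atLeft ℤ.+ ℤΣ.∑ n (λ z → [ isLeft z ]· g (P z))        ≡⟨ cong (ℤ._+_ (ℤΣ.∑ n atLeft)) (ℤΣ.∑-cong n atRight∘P) ⟩
    ℤΣ.∑ n atLeft ℤ.+ ℤΣ.∑ n (atRight ∘ P)                        ≡⟨ cong (ℤ._+_ (ℤΣ.∑ n atLeft)) (ℤΣ.∑-involution n P P<n P∘P atRight) ⟩
    ℤΣ.∑ n atLeft ℤ.+ ℤΣ.∑ n atRight                              ≡⟨ ℤΣ.∑-distrib n atLeft atRight ⟨
    ℤΣ.∑ n (λ z → atLeft z ℤ.+ atRight z)                         ≡⟨ ℤΣ.∑-cong n left+right ⟩
    ℤΣ.∑ n g                                                      ∎
    where
    open ≡-Reasoning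
    atLeft atRight : ℕ → ℤ
    atLeft z = [ isLeft z ]· g z
    atRight z = [ P z <ᵇ z ]· g z
    distrib : ∀ b {x y} → [ b ]· (x ℤ.+ y) ≡ [ b ]· x ℤ.+ [ b ]· y
    distrib true = refl
    distrib false = refl
    atRight∘P : ∀ z → z < n → [ isLeft z ]· g (P z) ≡ atRight (P z)
    atRight∘P z z<n rewrite P∘P z z<n = refl
    left+right : ∀ z → z < n → atLeft z ℤ.+ atRight z ≡ g z
    left+right z z<n with <-cmp z (P z)
    ... | tri< z<Pz _ _ rewrite <⇒<ᵇ≡true z<Pz | ≥⇒<ᵇ≡false (<⇒≤ z<Pz) = ℤₚ.+-identityʳ (g z)
    ... | tri≈ _ z≡Pz _ = ⊥-elim (P≢id z z<n (sym z≡Pz))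
    ... | tri> _ _ Pz<z rewrite <⇒<ᵇ≡true Pz<z | ≥⇒<ᵇ≡false (<⇒≤ Pz<z) = ℤₚ.+-identityˡ (g z)

  count-left : ∀ m → n ≡ m + m → ℕΣ.∑ n (𝟙 ∘ isLeft) ≡ m
  count-left m n≡m+m = +-cancel-double (trans (sym (count-invariant (λ _ → true) (λ _ _ → refl)))
                                              (trans (∑-ones n) n≡m+m))
    where
    +-cancel-double : ∀ {a b} → a + a ≡ b + b → a ≡ b
    +-cancel-double {a} {b} eq with <-cmp a b
    ... | tri< a<b _ _ = ⊥-elim (<-irrefl eq (+-mono-< a<b a<b))
    ... | tri≈ _ a≡b _ = a≡b
    ... | tri> _ _ b<a = ⊥-elim (<-irrefl (sym eq) (+-mono-< b<a b<a))

  between-closed : ∀ x y → x < n → x < P x → x < y → y < P x → x < P y × P y < P x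
  between-closed x y x<n x<Px x<y y<Px = Between-< x<Px (nonCrossing x y z≤n x<n (inj₁ (x<y , y<Px)))

  left-partner-odd : ∀ x → x < n → x < P x → ∃[ k ] (P x ≡ x + suc (k + k))
  left-partner-odd x x<n x<Px = K , P≡
    where
    inside : ℕ → Bool
    inside y = (x <ᵇ y) ∧ (y <ᵇ P x)
    inside⇒< : ∀ y → inside y ≡ true → x < y × y < P x
    inside⇒< y eq with x <ᵇ y in x<y | y <ᵇ P x in y<Px
    ... | true | true = <ᵇ≡true⇒< x<y , <ᵇ≡true⇒< y<Px
    <⇒inside : ∀ y → x < y × y < P x → inside y ≡ true
    <⇒inside y (x<y , y<Px) rewrite <⇒<ᵇ≡true x<y | <⇒<ᵇ≡true y<Px = refl
    inside-closed : ∀ y → inside y ≡ true → inside (P y) ≡ true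
    inside-closed y eq = <⇒inside (P y) (uncurry (between-closed x y x<n x<Px) (inside⇒< y eq))
    inside-invariant : ∀ y → y < n → inside (P y) ≡ inside y
    inside-invariant y y<n with inside y in eq | inside (P y) in eqP
    ... | true | true = refl
    ... | false | false = refl
    ... | true | false = case trans (sym (inside-closed y eq)) eqP of λ ()
    ... | false | true = case trans (sym (subst (λ t → inside t ≡ true) (P∘P y y<n) (inside-closed (P y) eqP))) eq of λ ()
    K : ℕ
    K = ℕΣ.∑ n (λ z → 𝟙 (inside z ∧ isLeft z))
    P≡ : P x ≡ x + suc (K + K)
    P≡ = begin
      P x                  ≡⟨ m∸n+n≡m x<Px ⟨
      P x ∸ suc x + suc x  ≡⟨ cong (_+ suc x) (trans (sym (∑-between n x (P x) x<Px (<⇒≤ (P<n x x<n)))) (count-invariant inside inside-invariant)) ⟩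
      K + K + suc x        ≡⟨ +-comm (K + K) (suc x) ⟩
      suc x + (K + K)      ≡⟨ +-suc x (K + K) ⟨
      x + suc (K + K)      ∎
      where open ≡-Reasoning

  next-left : ∀ x → x < n → suc x < P x → suc x < P (suc x)
  next-left x x<n 1+x<Px with between-closed x (suc x) x<n (<-trans (n<1+n x) 1+x<Px) (n<1+n x) 1+x<Px
  ... | x<P1+x , _ = ≤∧≢⇒< x<P1+x (λ eq → P≢id (suc x) (<-trans 1+x<Px (P<n x x<n)) (sym eq))

  right-after-edge : ∀ x → x < n → x < P x → suc (P x) < n → P (suc (P x)) < suc (P x) → P (suc (P x)) < x
  right-after-edge x x<n x<Px y<n q<y with <-cmp (P (suc (P x))) x
  ... | tri< q<x _ _ = q<x
  ... | tri≈ _ q≡x _ = ⊥-elim (<-irrefl (sym (trans (sym (P∘P (suc (P x)) y<n)) (cong P q≡x))) (n<1+n (P x)))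
  ... | tri> _ _ x<q with <-cmp (P (suc (P x))) (P x)
  ...   | tri< q<Px _ _ = ⊥-elim (<-asym (proj₂ (between-closed x (P (suc (P x))) x<n x<Px x<q q<Px))
                                        (subst (P x <_) (sym (P∘P (suc (P x)) y<n)) (n<1+n (P x))))
  ...   | tri≈ _ q≡Px _ = ⊥-elim (<-irrefl (trans (sym (P∘P x x<n)) (trans (cong P (sym q≡Px)) (P∘P (suc (P x)) y<n)))
                                          (<-trans x<Px (n<1+n (P x))))
  ...   | tri> _ _ Px<q = ⊥-elim (<-irrefl refl (<-≤-trans Px<q (≤-pred q<y)))

-- Edge weights and the weight formula

sign : ℕ → ℤ
sign z = if isEvenᵇ z then + 1 else - (+ 1)

sign-+-odd : ∀ z k → sign (z + suc (k + k)) ≡ - sign z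
sign-+-odd z k rewrite isEvenᵇ-+-odd z k with isEvenᵇ z
... | true = refl
... | false = refl

edgeLength-short : ∀ m k → suc (k + k) < m → edgeLength (m + m) 0 (suc (k + k)) ≡ k
edgeLength-short m k 2k+1<m = trans (cong ⌊_/2⌋ (m≤n⇒m⊓n≡m 2k≤rest)) (sym (n≡⌊n+n/2⌋ k))
  where
  2k≤rest : k + k ≤ m + m ∸ suc (k + k) ∸ 1
  2k≤rest = subst (k + k ≤_) (sym (∸-+-assoc (m + m) (suc (k + k)) 1))
    (m+n≤o⇒m≤o∸n (k + k) (subst (_≤ m + m) (double-odd k) (+-mono-≤ (<⇒≤ 2k+1<m) (<⇒≤ 2k+1<m))))
    where
    double-odd : ∀ k → suc (k + k) + suc (k + k) ≡ k + k + (suc (k + k) + 1)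
    double-odd = ℕSolver.solve-∀

edgeLength-long : ∀ m k → m < suc (k + k) → k < m → edgeLength (m + m) 0 (suc (k + k)) ≡ m ∸ suc k
edgeLength-long m k m<2k+1 k<m = trans (cong ⌊_/2⌋ (trans (m≥n⇒m⊓n≡n rest≤2k) rest≡)) (sym (n≡⌊n+n/2⌋ a))
  where
  a = m ∸ suc k
  m≡a+k+1 : m ≡ a + suc k
  m≡a+k+1 = sym (m∸n+n≡m k<m)
  rest≡ : m + m ∸ suc (k + k) ∸ 1 ≡ a + a
  rest≡ = begin
    m + m ∸ suc (k + k) ∸ 1                          ≡⟨ ∸-+-assoc (m + m) (suc (k + k)) 1 ⟩
    m + m ∸ (suc (k + k) + 1)                        ≡⟨ cong (λ t → t + t ∸ (suc (k + k) + 1)) m≡a+k+1 ⟩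
    a + suc k + (a + suc k) ∸ (suc (k + k) + 1)      ≡⟨ cong (_∸ (suc (k + k) + 1)) (double-expand a k) ⟩
    a + a + (suc (k + k) + 1) ∸ (suc (k + k) + 1)    ≡⟨ m+n∸n≡m (a + a) (suc (k + k) + 1) ⟩
    a + a                                            ∎
    where
    open ≡-Reasoning
    double-expand : ∀ a k → a + suc k + (a + suc k) ≡ a + a + (suc (k + k) + 1)
    double-expand = ℕSolver.solve-∀
  a<k : a < k
  a<k = +-cancelʳ-< k a k (subst (_≤ k + k) (+-suc a k) (subst (_≤ k + k) m≡a+k+1 (≤-pred m<2k+1)))
  rest≤2k : m + m ∸ suc (k + k) ∸ 1 ≤ k + k
  rest≤2k = subst (_≤ k + k) (sym rest≡) (+-mono-≤ (<⇒≤ a<k) (<⇒≤ a<k))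

2*-<-double : ∀ {a m} → a < m → 2 * a < m + m
2*-<-double {a} {m} a<m = subst (_< m + m) (cong (_+_ a) (sym (+-identityʳ a))) (+-mono-< a<m a<m)

double-≤-2* : ∀ {a m} → m ≤ a → m + m ≤ 2 * a
double-≤-2* {a} {m} m≤a = subst (m + m ≤_) (cong (_+_ a) (sym (+-identityʳ a))) (+-mono-≤ m≤a m≤a)

edgeWeight-short : ∀ m z k → suc (k + k) < m → edgeWeight (m + m) z (z + suc (k + k)) ≡ sign z ℤ.* + k
edgeWeight-short m z k 2k+1<m
  rewrite m+n∸m≡n z (suc (k + k)) | <⇒<ᵇ≡true (2*-<-double 2k+1<m) | edgeLength-short m k 2k+1<m
  = signed (isEvenᵇ z)
  where
  signed : ∀ b → (if b then + k else - (+ k)) ≡ (if b then + 1 else - (+ 1)) ℤ.* + k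
  signed true = sym (ℤₚ.*-identityˡ (+ k))
  signed false = sym (ℤₚ.-1*i≡-i (+ k))

edgeWeight-long : ∀ m z k → m < suc (k + k) → k < m →
                  edgeWeight (m + m) z (z + suc (k + k)) ≡ sign z ℤ.* (+ k ℤ.- + (m ∸ 1))
edgeWeight-long m z k m<2k+1 k<m
  rewrite m+n∸m≡n z (suc (k + k)) | ≥⇒<ᵇ≡false (double-≤-2* (<⇒≤ m<2k+1)) | edgeLength-long m k m<2k+1 k<m
        | isEvenᵇ-+-odd z k
  = trans (signed (isEvenᵇ z)) (cong (λ t → sign z ℤ.* (+ k ℤ.- t)) (sym m-1≡))
  where
  a = m ∸ suc k
  m-1≡ : + (m ∸ 1) ≡ + a ℤ.+ + k
  m-1≡ = trans (cong (λ t → + (t ∸ 1)) (sym (trans (sym (+-suc a k)) (m∸n+n≡m k<m)))) (ℤₚ.pos-+ a k)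
  negated : ∀ a k → - a ≡ + 1 ℤ.* (k ℤ.- (a ℤ.+ k))
  negated = ℤSolver.solve-∀
  negated′ : ∀ a k → a ≡ - (+ 1) ℤ.* (k ℤ.- (a ℤ.+ k))
  negated′ = ℤSolver.solve-∀
  signed : ∀ b → (if not b then + a else - (+ a)) ≡ (if b then + 1 else - (+ 1)) ℤ.* (+ k ℤ.- (+ a ℤ.+ + k))
  signed true = negated (+ a) (+ k)
  signed false = negated′ (+ a) (+ k)

alternating : ℕ → ℤ
alternating z = sign z ℤ.* + z

alternating-+-odd : ∀ z k → alternating (z + suc (k + k)) ≡ - sign z ℤ.* (+ z ℤ.+ (+ 1 ℤ.+ (+ k ℤ.+ + k)))
alternating-+-odd z k = cong₂ ℤ._*_ (sign-+-odd z k)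
  (trans (ℤₚ.pos-+ z (suc (k + k))) (cong (ℤ._+_ (+ z)) (trans (ℤₚ.pos-+ 1 (k + k)) (cong (ℤ._+_ (+ 1)) (ℤₚ.pos-+ k k)))))

alternating-pair : ∀ j → alternating (j + j) ℤ.+ alternating (suc (j + j)) ≡ - (+ 1)
alternating-pair j rewrite isEvenᵇ-suc (j + j) | isEvenᵇ-double j | ℤₚ.pos-+ 1 (j + j) = cancel (+ (j + j))
  where
  cancel : ∀ x → + 1 ℤ.* x ℤ.+ - (+ 1) ℤ.* (+ 1 ℤ.+ x) ≡ - (+ 1)
  cancel = ℤSolver.solve-∀

∑-alternating : ∀ j → ℤΣ.∑ (j + j) alternating ≡ - (+ j)
∑-alternating zero = refl
∑-alternating (suc j) = begin
  ℤΣ.∑ (suc j + suc j) alternating                                                ≡⟨ cong (λ t → ℤΣ.∑ t alternating) (+-suc (suc j) j) ⟩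
  ℤΣ.∑ (j + j) alternating ℤ.+ alternating (j + j) ℤ.+ alternating (suc (j + j))  ≡⟨ ℤₚ.+-assoc (ℤΣ.∑ (j + j) alternating) _ _ ⟩
  ℤΣ.∑ (j + j) alternating ℤ.+ (alternating (j + j) ℤ.+ alternating (suc (j + j)))  ≡⟨ cong₂ ℤ._+_ (∑-alternating j) (alternating-pair j) ⟩
  - (+ j) ℤ.+ - (+ 1)                                                             ≡⟨ ℤₚ.neg-distrib-+ (+ j) (+ 1) ⟨
  - (+ j ℤ.+ + 1)                                                                 ≡⟨ cong -_ (ℤₚ.pos-+ j 1) ⟨
  - (+ (j + 1))                                                                   ≡⟨ cong (λ t → - (+ t)) (+-comm j 1) ⟩
  - (+ suc j)                                                                     ∎
  where open ≡-Reasoning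

twice-edgeWeight-long : ∀ m z k → m < suc (k + k) → k < m →
  + 2 ℤ.* edgeWeight (m + m) z (z + suc (k + k))
    ≡ - (alternating z ℤ.+ alternating (z + suc (k + k))) ℤ.- sign z ℤ.- + 2 ℤ.* + (m ∸ 1) ℤ.* sign z
twice-edgeWeight-long m z k m<2k+1 k<m rewrite edgeWeight-long m z k m<2k+1 k<m | alternating-+-odd z k
  = identity (sign z) (+ z) (+ k) (+ (m ∸ 1))
  where
  identity : ∀ s z k c → + 2 ℤ.* (s ℤ.* (k ℤ.- c))
    ≡ - (s ℤ.* z ℤ.+ - s ℤ.* (z ℤ.+ (+ 1 ℤ.+ (k ℤ.+ k)))) ℤ.- s ℤ.- + 2 ℤ.* c ℤ.* s
  identity = ℤSolver.solve-∀

twice-edgeWeight-short : ∀ m z k → suc (k + k) < m →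
  + 2 ℤ.* edgeWeight (m + m) z (z + suc (k + k))
    ≡ - (alternating z ℤ.+ alternating (z + suc (k + k))) ℤ.- sign z ℤ.- + 2 ℤ.* + (m ∸ 1) ℤ.* + 0
twice-edgeWeight-short m z k 2k+1<m rewrite edgeWeight-short m z k 2k+1<m | alternating-+-odd z k
  = identity (sign z) (+ z) (+ k) (+ (m ∸ 1))
  where
  identity : ∀ s z k c → + 2 ℤ.* (s ℤ.* k)
    ≡ - (s ℤ.* z ℤ.+ - s ℤ.* (z ℤ.+ (+ 1 ℤ.+ (k ℤ.+ k)))) ℤ.- s ℤ.- + 2 ℤ.* c ℤ.* + 0
  identity = ℤSolver.solve-∀

[]·sign≡ : ∀ b z → [ b ]· sign z ≡ + 𝟙 (b ∧ isEvenᵇ z) ℤ.- + 𝟙 (b ∧ not (isEvenᵇ z))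
[]·sign≡ false z = refl
[]·sign≡ true z with isEvenᵇ z
... | true = refl
... | false = refl

∑-[]·sign : ∀ k (b : ℕ → Bool) →
  ℤΣ.∑ k (λ z → [ b z ]· sign z) ≡ + ℕΣ.∑ k (λ z → 𝟙 (b z ∧ isEvenᵇ z)) ℤ.- + ℕΣ.∑ k (λ z → 𝟙 (b z ∧ not (isEvenᵇ z)))
∑-[]·sign k b = begin
  ℤΣ.∑ k (λ z → [ b z ]· sign z)                        ≡⟨ ℤΣ.∑-cong k (λ z _ → []·sign≡ (b z) z) ⟩
  ℤΣ.∑ k (λ z → + evens z ℤ.- + odds z)                 ≡⟨ ℤΣ.∑-distrib k _ _ ⟩
  ℤΣ.∑ k (+_ ∘ evens) ℤ.+ ℤΣ.∑ k (λ z → - (+ odds z))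
    ≡⟨ cong₂ ℤ._+_ (∑-pos k evens) (trans (cong -_ (∑-pos k odds)) (∑-neg k (+_ ∘ odds))) ⟨
  + ℕΣ.∑ k evens ℤ.- + ℕΣ.∑ k odds                      ∎
  where
  open ≡-Reasoning
  evens odds : ℕ → ℕ
  evens z = 𝟙 (b z ∧ isEvenᵇ z)
  odds z = 𝟙 (b z ∧ not (isEvenᵇ z))

∑-linear : ∀ k (f g h : ℕ → ℤ) c →
  ℤΣ.∑ k (λ z → - f z ℤ.- g z ℤ.- c ℤ.* h z) ≡ - ℤΣ.∑ k f ℤ.- ℤΣ.∑ k g ℤ.- c ℤ.* ℤΣ.∑ k h
∑-linear k f g h c = begin
  ℤΣ.∑ k (λ z → - f z ℤ.- g z ℤ.- c ℤ.* h z)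
    ≡⟨ ℤΣ.∑-distrib k _ _ ⟩
  ℤΣ.∑ k (λ z → - f z ℤ.- g z) ℤ.+ ℤΣ.∑ k (λ z → - (c ℤ.* h z))
    ≡⟨ cong₂ ℤ._+_ (ℤΣ.∑-distrib k _ _) (sym (∑-neg k _)) ⟩
  ℤΣ.∑ k (-_ ∘ f) ℤ.+ ℤΣ.∑ k (-_ ∘ g) ℤ.- ℤΣ.∑ k (λ z → c ℤ.* h z)
    ≡⟨ cong₂ (λ u v → u ℤ.+ v ℤ.- ℤΣ.∑ k (λ z → c ℤ.* h z)) (∑-neg k f) (∑-neg k g) ⟨
  - ℤΣ.∑ k f ℤ.- ℤΣ.∑ k g ℤ.- ℤΣ.∑ k (λ z → c ℤ.* h z)
    ≡⟨ cong (λ u → - ℤΣ.∑ k f ℤ.- ℤΣ.∑ k g ℤ.- u) (∑-scale c k h) ⟨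
  - ℤΣ.∑ k f ℤ.- ℤΣ.∑ k g ℤ.- c ℤ.* ℤΣ.∑ k h
    ∎
  where open ≡-Reasoning

module EvenWeight {m h : ℕ} (m≡h+h : m ≡ h + h) (0<m : 0 < m) {P : ℕ → ℕ} (M : IsMatchingOn P 0 (m + m)) where
  open Structure M public

  -- A long edge spans more than m steps; its sign is then read off at its right endpoint.
  isLong : ℕ → Bool
  isLong z = (m + z) <ᵇ P z

  evenLeft oddLeft evenLong oddLong : ℕ
  evenLeft = ℕΣ.∑ (m + m) (λ z → 𝟙 (isLeft z ∧ isEvenᵇ z))
  oddLeft = ℕΣ.∑ (m + m) (λ z → 𝟙 (isLeft z ∧ not (isEvenᵇ z)))
  evenLong = ℕΣ.∑ (m + m) (λ z → 𝟙 (isLong z ∧ isEvenᵇ z))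
  oddLong = ℕΣ.∑ (m + m) (λ z → 𝟙 (isLong z ∧ not (isEvenᵇ z)))

  W : ℤ
  W = ℤΣ.∑ (m + m) (leftEdgeWeight (m + m) P)

  evenLeft+oddLeft : evenLeft + oddLeft ≡ m
  evenLeft+oddLeft = trans (sym (ℕΣ.∑-distrib (m + m) _ _))
                           (trans (ℕΣ.∑-cong (m + m) (λ z _ → split (isLeft z) (isEvenᵇ z))) (count-left m refl))
    where
    split : ∀ a b → 𝟙 (a ∧ b) + 𝟙 (a ∧ not b) ≡ 𝟙 a
    split true true = refl
    split true false = refl
    split false b = refl

  twice-leftEdgeWeight : ∀ z → z < m + m →
    + 2 ℤ.* leftEdgeWeight (m + m) P z
      ≡ - [ isLeft z ]· (alternating z ℤ.+ alternating (P z)) ℤ.- [ isLeft z ]· sign z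
        ℤ.- + 2 ℤ.* + (m ∸ 1) ℤ.* [ isLong z ]· sign z
  twice-leftEdgeWeight z z<n with z <ᵇ P z in left
  ... | false rewrite ≥⇒<ᵇ≡false {m + z} {P z} (≤-trans (<ᵇ≡false⇒≥ left) (m≤n+m z m)) = zeros (+ 2 ℤ.* + (m ∸ 1))
    where
    zeros : ∀ c → + 2 ℤ.* + 0 ≡ - (+ 0) ℤ.- + 0 ℤ.- c ℤ.* + 0
    zeros = ℤSolver.solve-∀
  ... | true with left-partner-odd z z<n (<ᵇ≡true⇒< left)
  ...   | k , Pz≡ with (m + z) <ᵇ P z in long
  ...     | true = subst (λ t → + 2 ℤ.* edgeWeight (m + m) z t
                                  ≡ - (alternating z ℤ.+ alternating t) ℤ.- sign z ℤ.- + 2 ℤ.* + (m ∸ 1) ℤ.* sign z)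
                             (sym Pz≡) (twice-edgeWeight-long m z k m<2k+1 k<m)
    where
    m<2k+1 : m < suc (k + k)
    m<2k+1 = +-cancelʳ-< z m (suc (k + k)) (subst (m + z <_) (trans Pz≡ (+-comm z _)) (<ᵇ≡true⇒< long))
    k<m : k < m
    k<m = ≰⇒> (λ m≤k → <⇒≱ (≤-<-trans (≤-trans (n≤1+n (k + k)) (m≤n+m _ z)) (subst (_< m + m) Pz≡ (P<n z z<n)))
                                  (+-mono-≤ m≤k m≤k))
  ...     | false = subst (λ t → + 2 ℤ.* edgeWeight (m + m) z t
                                  ≡ - (alternating z ℤ.+ alternating t) ℤ.- sign z ℤ.- + 2 ℤ.* + (m ∸ 1) ℤ.* + 0)
                             (sym Pz≡) (twice-edgeWeight-short m z k 2k+1<m)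
    where
    2k+1≤m : suc (k + k) ≤ m
    2k+1≤m = +-cancelʳ-≤ z (suc (k + k)) m (subst (_≤ m + z) (trans Pz≡ (+-comm z _)) (<ᵇ≡false⇒≥ long))
    2k+1<m : suc (k + k) < m
    2k+1<m = ≤∧≢⇒< 2k+1≤m (λ eq → odd≢double k h (trans eq m≡h+h))

  weight-formula : W ≡ + oddLeft ℤ.- + (m ∸ 1) ℤ.* (+ evenLong ℤ.- + oddLong)
  weight-formula = ℤₚ.*-cancelˡ-≡ (+ 2) _ _ (begin
    + 2 ℤ.* W
      ≡⟨ ∑-scale (+ 2) (m + m) _ ⟩
    ℤΣ.∑ (m + m) (λ z → + 2 ℤ.* leftEdgeWeight (m + m) P z)
      ≡⟨ ℤΣ.∑-cong (m + m) twice-leftEdgeWeight ⟩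
    ℤΣ.∑ (m + m) (λ z → - edgeSum z ℤ.- leftSign z ℤ.- c ℤ.* longSign z)
      ≡⟨ ∑-linear (m + m) edgeSum leftSign longSign c ⟩
    - ℤΣ.∑ (m + m) edgeSum ℤ.- ℤΣ.∑ (m + m) leftSign ℤ.- c ℤ.* ℤΣ.∑ (m + m) longSign
      ≡⟨ cong₂ (λ u v → - u ℤ.- v ℤ.- c ℤ.* ℤΣ.∑ (m + m) longSign)
               (trans (∑-edges alternating) (∑-alternating m)) (∑-[]·sign (m + m) isLeft) ⟩
    - (- (+ m)) ℤ.- (+ evenLeft ℤ.- + oddLeft) ℤ.- c ℤ.* ℤΣ.∑ (m + m) longSign
      ≡⟨ cong₂ (λ u v → - (- u) ℤ.- (+ evenLeft ℤ.- + oddLeft) ℤ.- c ℤ.* v)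
               (trans (cong +_ (sym evenLeft+oddLeft)) (ℤₚ.pos-+ evenLeft oddLeft)) (∑-[]·sign (m + m) isLong) ⟩
    - (- (+ evenLeft ℤ.+ + oddLeft)) ℤ.- (+ evenLeft ℤ.- + oddLeft) ℤ.- c ℤ.* (+ evenLong ℤ.- + oddLong)
      ≡⟨ identity (+ evenLeft) (+ oddLeft) (+ (m ∸ 1)) (+ evenLong ℤ.- + oddLong) ⟩
    + 2 ℤ.* (+ oddLeft ℤ.- + (m ∸ 1) ℤ.* (+ evenLong ℤ.- + oddLong))
      ∎)
    where
    open ≡-Reasoning
    c : ℤ
    c = + 2 ℤ.* + (m ∸ 1)
    edgeSum leftSign longSign : ℕ → ℤ
    edgeSum z = [ isLeft z ]· (alternating z ℤ.+ alternating (P z))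
    leftSign z = [ isLeft z ]· sign z
    longSign z = [ isLong z ]· sign z
    identity : ∀ e a d l → - (- (e ℤ.+ a)) ℤ.- (e ℤ.- a) ℤ.- + 2 ℤ.* d ℤ.* l ≡ + 2 ℤ.* (a ℤ.- d ℤ.* l)
    identity = ℤSolver.solve-∀

  isLong⇒isLeft : ∀ z → isLong z ≡ true → z < P z
  isLong⇒isLeft z long = ≤-<-trans (m≤n+m z m) (<ᵇ≡true⇒< long)

  longBelow longEvenBelow longOddBelow : ℕ → ℕ
  longBelow c = ℕΣ.∑ c (𝟙 ∘ isLong)
  longEvenBelow c = ℕΣ.∑ c (λ z → 𝟙 (isLong z ∧ isEvenᵇ z))
  longOddBelow c = ℕΣ.∑ c (λ z → 𝟙 (isLong z ∧ not (isEvenᵇ z)))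

  -- Left of a long left endpoint x, every point is matched left of x or starts a long edge over x.
  isEvenᵇ-long : ∀ x → x < m + m → isLong x ≡ true → isEvenᵇ x ≡ isEvenᵇ (longBelow x)
  isEvenᵇ-long x x<n long = trans (cong isEvenᵇ x≡) (isEvenᵇ-+-double K (longBelow x))
    where
    m+x<Px : m + x < P x
    m+x<Px = <ᵇ≡true⇒< long
    x<Px : x < P x
    x<Px = isLong⇒isLeft x long
    x<m : x < m
    x<m = +-cancelˡ-< m x m (<-trans m+x<Px (P<n x x<n))
    matchedLeft-or-long : ∀ z → z < x → 𝟙 (P z <ᵇ x) + 𝟙 (isLong z) ≡ 1
    matchedLeft-or-long z z<x with <-cmp (P z) x
    ... | tri< Pz<x _ _ rewrite <⇒<ᵇ≡true Pz<x | ≥⇒<ᵇ≡false {m + z} {P z} (<⇒≤ (<-≤-trans Pz<x (≤-trans (<⇒≤ x<m) (m≤m+n m z))))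
      = refl
    ... | tri≈ _ Pz≡x _ = ⊥-elim (<-asym z<x (subst (x <_) (trans (cong P (sym Pz≡x)) (P∘P z (<-trans z<x x<n))) x<Px))
    ... | tri> _ _ x<Pz rewrite ≥⇒<ᵇ≡false (<⇒≤ x<Pz) = cong 𝟙 (<⇒<ᵇ≡true m+z<Pz)
      where
      z<n = <-trans z<x x<n
      m+z<Pz : m + z < P z
      m+z<Pz with <-cmp (P z) (P x)
      ... | tri< Pz<Px _ _ = ⊥-elim (<-asym z<x (proj₁ (subst (λ t → x < t × t < P x) (P∘P z z<n)
                                                           (between-closed x (P z) x<n x<Px x<Pz Pz<Px))))
      ... | tri≈ _ Pz≡Px _ = ⊥-elim (<-irrefl (trans (sym (P∘P z z<n)) (trans (cong P Pz≡Px) (P∘P x x<n))) z<x)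
      ... | tri> _ _ Px<Pz = <-trans (+-monoʳ-< m z<x) (<-trans m+x<Px Px<Pz)
    inPairs : ℕ → Bool
    inPairs z = (z <ᵇ x) ∧ (P z <ᵇ x)
    K : ℕ
    K = ℕΣ.∑ (m + m) (λ z → 𝟙 (inPairs z ∧ isLeft z))
    matchedLeft≡K+K : ℕΣ.∑ x (λ z → 𝟙 (P z <ᵇ x)) ≡ K + K
    matchedLeft≡K+K = begin
      ℕΣ.∑ x (λ z → 𝟙 (P z <ᵇ x))
        ≡⟨ ℕΣ.∑-cong x (λ z z<x → cong (λ t → 𝟙 (t ∧ (P z <ᵇ x))) (sym (<⇒<ᵇ≡true z<x))) ⟩
      ℕΣ.∑ x (𝟙 ∘ inPairs)
        ≡⟨ ℕΣ.∑-extend (<⇒≤ x<n) (𝟙 ∘ inPairs) (λ z x≤z → cong (λ t → 𝟙 (t ∧ (P z <ᵇ x))) (≥⇒<ᵇ≡false x≤z)) ⟩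
      ℕΣ.∑ (m + m) (𝟙 ∘ inPairs)
        ≡⟨ count-invariant inPairs (λ z z<n → trans (cong (λ t → (P z <ᵇ x) ∧ (t <ᵇ x)) (P∘P z z<n)) (∧-comm (P z <ᵇ x) (z <ᵇ x))) ⟩
      K + K
        ∎
      where open ≡-Reasoning
    x≡ : x ≡ K + K + longBelow x
    x≡ = begin
      x                                                         ≡⟨ ∑-ones x ⟨
      ℕΣ.∑ x (λ _ → 1)                                          ≡⟨ ℕΣ.∑-cong x (λ z z<x → sym (matchedLeft-or-long z z<x)) ⟩
      ℕΣ.∑ x (λ z → 𝟙 (P z <ᵇ x) + 𝟙 (isLong z))               ≡⟨ ℕΣ.∑-distrib x _ _ ⟩
      ℕΣ.∑ x (λ z → 𝟙 (P z <ᵇ x)) + longBelow x                ≡⟨ cong (_+ longBelow x) matchedLeft≡K+K ⟩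
      K + K + longBelow x                                       ∎
      where open ≡-Reasoning

  longEvenBelow≡ : ∀ c → c ≤ m + m → longEvenBelow c ≡ longOddBelow c + 𝟙 (not (isEvenᵇ (longBelow c)))
  longEvenBelow≡ zero _ = refl
  longEvenBelow≡ (suc c) c<n with isLong c in long
  ... | false rewrite +-identityʳ (longEvenBelow c) | +-identityʳ (longOddBelow c) | +-identityʳ (longBelow c)
    = longEvenBelow≡ c (<⇒≤ c<n)
  ... | true rewrite isEvenᵇ-long c c<n long | +-comm (longBelow c) 1 with isEvenᵇ (longBelow c) | longEvenBelow≡ c (<⇒≤ c<n)
  ...   | true | ih = cong (_+ 1) ih
  ...   | false | ih = trans (+-identityʳ _) (trans ih (sym (+-identityʳ _)))

  evenLong≡oddLong⊎suc : evenLong ≡ oddLong ⊎ evenLong ≡ suc oddLong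
  evenLong≡oddLong⊎suc with isEvenᵇ (longBelow (m + m)) | longEvenBelow≡ (m + m) ≤-refl
  ... | true | eq = inj₁ (trans eq (+-identityʳ oddLong))
  ... | false | eq = inj₂ (trans eq (+-comm oddLong 1))

  weight-balanced : evenLong ≡ oddLong → W ≡ + oddLeft
  weight-balanced eq = begin
    W                                                         ≡⟨ weight-formula ⟩
    + oddLeft ℤ.- + (m ∸ 1) ℤ.* (+ evenLong ℤ.- + oddLong)   ≡⟨ cong (λ t → + oddLeft ℤ.- + (m ∸ 1) ℤ.* (+ t ℤ.- + oddLong)) eq ⟩
    + oddLeft ℤ.- + (m ∸ 1) ℤ.* (+ oddLong ℤ.- + oddLong)    ≡⟨ cancel (+ oddLeft) (+ (m ∸ 1)) (+ oddLong) ⟩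
    + oddLeft                                                 ∎
    where
    open ≡-Reasoning
    cancel : ∀ a c l → a ℤ.- c ℤ.* (l ℤ.- l) ≡ a
    cancel = ℤSolver.solve-∀

  weight-unbalanced : evenLong ≡ suc oddLong → W ≡ + oddLeft ℤ.- + (m ∸ 1)
  weight-unbalanced eq = begin
    W                                                           ≡⟨ weight-formula ⟩
    + oddLeft ℤ.- + (m ∸ 1) ℤ.* (+ evenLong ℤ.- + oddLong)     ≡⟨ cong (λ t → + oddLeft ℤ.- + (m ∸ 1) ℤ.* (+ t ℤ.- + oddLong)) eq ⟩
    + oddLeft ℤ.- + (m ∸ 1) ℤ.* (+ (1 + oddLong) ℤ.- + oddLong) ≡⟨ cong (λ t → + oddLeft ℤ.- + (m ∸ 1) ℤ.* (t ℤ.- + oddLong)) (ℤₚ.pos-+ 1 oddLong) ⟩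
    + oddLeft ℤ.- + (m ∸ 1) ℤ.* (+ 1 ℤ.+ + oddLong ℤ.- + oddLong) ≡⟨ cancel (+ oddLeft) (+ (m ∸ 1)) (+ oddLong) ⟩
    + oddLeft ℤ.- + (m ∸ 1)                                     ∎
    where
    open ≡-Reasoning
    cancel : ∀ a c l → a ℤ.- c ℤ.* (+ 1 ℤ.+ l ℤ.- l) ≡ a ℤ.- c
    cancel = ℤSolver.solve-∀

  private
    𝟙-∧-pos : ∀ {a b} → 0 < 𝟙 (a ∧ b) → a ≡ true × b ≡ true
    𝟙-∧-pos {true} {true} _ = refl , refl

    0<n : 0 < m + m
    0<n = <-≤-trans 0<m (m≤m+n m m)

    isLeft-0 : 0 < P 0
    isLeft-0 = n≢0⇒n>0 (P≢id 0 0<n)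

    successor-isLeft : ∀ x → x < m + m → isLong x ≡ true → suc x < m + m × suc x < P (suc x)
    successor-isLeft x x<n long = <-trans 1+x<Px (P<n x x<n) , next-left x x<n 1+x<Px
      where
      1+x<Px : suc x < P x
      1+x<Px = <-≤-trans (s≤s (+-monoˡ-≤ x 0<m)) (<ᵇ≡true⇒< long)

    evenLeft-term : ∀ y → y < P y → isEvenᵇ y ≡ true → 𝟙 (isLeft y ∧ isEvenᵇ y) ≡ 1
    evenLeft-term y y<Py even rewrite <⇒<ᵇ≡true y<Py | even = refl

    two≤evenLeft : ∀ y → 0 < y → y < m + m → y < P y → isEvenᵇ y ≡ true → 2 ≤ evenLeft
    two≤evenLeft y 0<y y<n y<Py even = two≤∑ (m + m) _ y 0<y y<n (evenLeft-term 0 isLeft-0 refl) (evenLeft-term y y<Py even)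

  1≤evenLeft : 1 ≤ evenLeft
  1≤evenLeft = subst (_≤ evenLeft) (evenLeft-term 0 isLeft-0 refl) (term≤∑ (m + m) _ 0 0<n)

  1≤oddLeft : evenLong ≡ suc oddLong → 1 ≤ oddLeft
  1≤oddLeft eq with ∑-positive (m + m) _ (subst (0 <_) (sym eq) z<s)
  ... | x , x<n , pos with 𝟙-∧-pos {isLong x} pos
  ...   | long , even with successor-isLeft x x<n long
  ...     | 1+x<n , 1+x<P1+x = subst (_≤ oddLeft) oddLeft-term (term≤∑ (m + m) _ (suc x) 1+x<n)
    where
    oddLeft-term : 𝟙 (isLeft (suc x) ∧ not (isEvenᵇ (suc x))) ≡ 1
    oddLeft-term rewrite <⇒<ᵇ≡true 1+x<P1+x | isEvenᵇ-suc x | even = refl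

  2≤evenLeft : evenLong ≡ oddLong → 2 ≤ evenLeft
  2≤evenLeft eq with oddLong in oddLong≡
  ... | suc _ with ∑-positive (m + m) _ (subst (0 <_) (sym oddLong≡) z<s)
  ...   | x , x<n , pos with 𝟙-∧-pos {isLong x} pos
  ...     | long , odd with successor-isLeft x x<n long
  ...       | 1+x<n , 1+x<P1+x = two≤evenLeft (suc x) z<s 1+x<n 1+x<P1+x (trans (isEvenᵇ-suc x) odd)
  2≤evenLeft eq | zero = two≤evenLeft (suc b) z<s 1+b<n 1+b<P1+b 1+b-even
    where
    b = P 0
    k = proj₁ (left-partner-odd 0 0<n isLeft-0)
    b≡ : b ≡ suc (k + k)
    b≡ = proj₂ (left-partner-odd 0 0<n isLeft-0)
    1+b-even : isEvenᵇ (suc b) ≡ true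
    1+b-even = trans (isEvenᵇ-suc b) (cong not (trans (cong isEvenᵇ b≡) (trans (isEvenᵇ-suc (k + k)) (cong not (isEvenᵇ-double k)))))
    short : isLong 0 ≡ false
    short with isLong 0 in long
    ... | false = refl
    ... | true = ⊥-elim (<-irrefl (sym eq) (subst (_≤ evenLong) (cong (λ t → 𝟙 (t ∧ true)) long) (term≤∑ (m + m) _ 0 0<n)))
    b<m : b < m
    b<m = ≤∧≢⇒< (subst (b ≤_) (+-identityʳ m) (<ᵇ≡false⇒≥ short)) (λ b≡m → odd≢double k h (trans (sym b≡) (trans b≡m m≡h+h)))
    1+b<n : suc b < m + m
    1+b<n = ≤-<-trans b<m (m<m+n m 0<m)
    1+b<P1+b : suc b < P (suc b)
    1+b<P1+b with <-cmp (suc b) (P (suc b))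
    ... | tri< 1+b<P1+b _ _ = 1+b<P1+b
    ... | tri≈ _ 1+b≡P1+b _ = ⊥-elim (P≢id (suc b) 1+b<n (sym 1+b≡P1+b))
    ... | tri> _ _ P1+b<1+b = case right-after-edge 0 0<n isLeft-0 1+b<n P1+b<1+b of λ ()

  oddLeft≤ : ∀ k → k ≤ evenLeft → oddLeft ≤ m ∸ k
  oddLeft≤ k k≤evenLeft = m+n≤o⇒m≤o∸n oddLeft
    (subst (oddLeft + k ≤_) (trans (+-comm oddLeft evenLeft) evenLeft+oddLeft) (+-monoʳ-≤ oddLeft k≤evenLeft))

  weight-bounds : - (+ (m ∸ 2)) ℤ.≤ W × W ℤ.≤ + (m ∸ 2)
  weight-bounds with evenLong≡oddLong⊎suc
  ... | inj₁ eq rewrite weight-balanced eq = ℤₚ.neg-≤-pos , ℤ.+≤+ (oddLeft≤ 2 (2≤evenLeft eq))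
  ... | inj₂ eq rewrite weight-unbalanced eq | ℤₚ.[+m]-[+n]≡m⊖n oddLeft (m ∸ 1) | ℤₚ.⊖-≤ (oddLeft≤ 1 1≤evenLeft)
    = ℤₚ.neg-mono-≤ (ℤ.+≤+ (subst ((m ∸ 1) ∸ oddLeft ≤_) (∸-+-assoc m 1 1) (∸-monoʳ-≤ (m ∸ 1) (1≤oddLeft eq))))
    , ℤₚ.neg-≤-pos

-- Constructions

adjacent : ℕ → ℕ
adjacent z = if isEvenᵇ z then suc z else z ∸ 1

adjacent-isMatchingOn : ∀ k → IsMatchingOn adjacent 0 (k + k)
adjacent-isMatchingOn k = record { range = range ; involutive = involutive ; noFixed = noFixed ; nonCrossing = nonCrossing }
  where
  odd⇒suc : ∀ a → isEvenᵇ a ≡ false → ∃[ a′ ] (a ≡ suc a′ × isEvenᵇ a′ ≡ true)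
  odd⇒suc (suc a′) odd = a′ , refl , trans (sym (not-involutive _)) (cong not (trans (sym (isEvenᵇ-suc a′)) odd))
  range : ∀ z → 0 ≤ z → z < k + k → 0 ≤ adjacent z × adjacent z < k + k
  range z _ z<2k with isEvenᵇ z in even
  ... | true = z≤n , ≤∧≢⇒< z<2k (λ 1+z≡2k → case trans (sym (isEvenᵇ-double k))
                                                   (trans (cong isEvenᵇ (sym 1+z≡2k)) (trans (isEvenᵇ-suc z) (cong not even))) of λ ())
  ... | false = z≤n , ≤-<-trans (m∸n≤m z 1) z<2k
  involutive : ∀ z → 0 ≤ z → z < k + k → adjacent (adjacent z) ≡ z
  involutive z _ _ with isEvenᵇ z in even
  ... | true rewrite isEvenᵇ-suc z | even = refl
  ... | false with odd⇒suc z even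
  ...   | a′ , refl , even′ rewrite even′ = refl
  noFixed : ∀ z → 0 ≤ z → z < k + k → adjacent z ≢ z
  noFixed z _ _ with isEvenᵇ z in even
  ... | true = λ 1+z≡z → <-irrefl (sym 1+z≡z) (n<1+n z)
  ... | false with odd⇒suc z even
  ...   | a′ , refl , _ = λ a′≡1+a′ → <-irrefl a′≡1+a′ (n<1+n a′)
  nonCrossing : ∀ a b → 0 ≤ a → a < k + k → Between b a (adjacent a) → Between (adjacent b) a (adjacent a)
  nonCrossing a b _ _ between with isEvenᵇ a in even
  nonCrossing a b _ _ (inj₁ (a<b , b<1+a)) | true = ⊥-elim (<-irrefl refl (<-≤-trans a<b (≤-pred b<1+a)))
  nonCrossing a b _ _ (inj₂ (1+a<b , b<a)) | true = ⊥-elim (<-asym 1+a<b (<-trans b<a (n<1+n a)))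
  nonCrossing a b _ _ between | false with odd⇒suc a even
  nonCrossing .(suc a′) b _ _ (inj₁ (1+a′<b , b<a′)) | false | a′ , refl , _ = ⊥-elim (<-asym 1+a′<b (<-trans b<a′ (n<1+n a′)))
  nonCrossing .(suc a′) b _ _ (inj₂ (a′<b , b<1+a′)) | false | a′ , refl , _ = ⊥-elim (<-irrefl refl (<-≤-trans a′<b (≤-pred b<1+a′)))

weight-adjacent : ∀ k → weight (toNCMatching (adjacent-isMatchingOn k)) ≡ + 0
weight-adjacent k = trans (weight-toNCMatching (adjacent-isMatchingOn k)) (ℤΣ.∑-zero (k + k) _ edge-zero)
  where
  1+z∸z : ∀ z → suc z ∸ z ≡ 1
  1+z∸z zero = refl
  1+z∸z (suc z) = 1+z∸z z
  length-zero : ∀ b → (if b then + 0 else - (+ 0)) ≡ + 0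
  length-zero true = refl
  length-zero false = refl
  edge-zero : ∀ z → z < k + k → leftEdgeWeight (k + k) adjacent z ≡ + 0
  edge-zero z _ with isEvenᵇ z
  ... | true rewrite <⇒<ᵇ≡true (n<1+n z) | 1+z∸z z = length-zero _
  ... | false rewrite ≥⇒<ᵇ≡false (m∸n≤m z 1) = refl

shift : ℕ → (ℕ → ℕ) → ℕ → ℕ
shift s f z = s + f (z ∸ s)

shift-+ : ∀ s f r → shift s f (s + r) ≡ s + f r
shift-+ s f r = cong (λ t → s + f t) (m+n∸m≡n s r)

shift-isMatchingOn : ∀ {f S} s → IsMatchingOn f 0 S → IsMatchingOn (shift s f) s (s + S)
shift-isMatchingOn {f} {S} s M = record { range = range ; involutive = involutive ; noFixed = noFixed ; nonCrossing = nonCrossing }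
  where
  module M = IsMatchingOn M
  s+[z∸s] : ∀ {z} → s ≤ z → s + (z ∸ s) ≡ z
  s+[z∸s] = m+[n∸m]≡n
  offset< : ∀ {z} → s ≤ z → z < s + S → z ∸ s < S
  offset< s≤z z<s+S = +-cancelˡ-< s _ _ (subst (_< s + S) (sym (s+[z∸s] s≤z)) z<s+S)
  range : ∀ z → s ≤ z → z < s + S → s ≤ shift s f z × shift s f z < s + S
  range z s≤z z<s+S = m≤m+n s _ , +-monoʳ-< s (proj₂ (M.range (z ∸ s) z≤n (offset< s≤z z<s+S)))
  involutive : ∀ z → s ≤ z → z < s + S → shift s f (shift s f z) ≡ z
  involutive z s≤z z<s+S = trans (shift-+ s f (f (z ∸ s))) (trans (cong (_+_ s) (M.involutive (z ∸ s) z≤n (offset< s≤z z<s+S))) (s+[z∸s] s≤z))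
  noFixed : ∀ z → s ≤ z → z < s + S → shift s f z ≢ z
  noFixed z s≤z z<s+S eq = M.noFixed (z ∸ s) z≤n (offset< s≤z z<s+S) (+-cancelˡ-≡ s _ _ (trans eq (sym (s+[z∸s] s≤z))))
  nonCrossing : ∀ a b → s ≤ a → a < s + S → Between b a (shift s f a) → Between (shift s f b) a (shift s f a)
  nonCrossing a b s≤a a<s+S between
    with s≤b ← Between-lower s≤a (m≤m+n s _) between
    = subst (λ t → Between (shift s f b) t (shift s f a)) (s+[z∸s] s≤a)
        (Between-+ˡ s (M.nonCrossing (a ∸ s) (b ∸ s) z≤n (offset< s≤a a<s+S)
          (Between-+ˡ⁻¹ s (subst₂ (λ u v → Between u v (shift s f a)) (sym (s+[z∸s] s≤b)) (sym (s+[z∸s] s≤a)) between))))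

glue : ℕ → (ℕ → ℕ) → (ℕ → ℕ) → ℕ → ℕ
glue mid f g z = if z <ᵇ mid then f z else g z

glue-< : ∀ {mid f g z} → z < mid → glue mid f g z ≡ f z
glue-< z<mid rewrite <⇒<ᵇ≡true z<mid = refl

glue-≥ : ∀ {mid f g z} → mid ≤ z → glue mid f g z ≡ g z
glue-≥ mid≤z rewrite ≥⇒<ᵇ≡false mid≤z = refl

glue-isMatchingOn : ∀ {f g lo mid hi} → lo ≤ mid → mid ≤ hi → IsMatchingOn f lo mid → IsMatchingOn g mid hi →
                    IsMatchingOn (glue mid f g) lo hi
glue-isMatchingOn {f} {g} {lo} {mid} {hi} lo≤mid mid≤hi F G = record
  { range = range ; involutive = involutive ; noFixed = noFixed ; nonCrossing = nonCrossing }
  where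
  module F = IsMatchingOn F
  module G = IsMatchingOn G
  h = glue mid f g
  range : ∀ z → lo ≤ z → z < hi → lo ≤ h z × h z < hi
  range z lo≤z z<hi with z <? mid
  ... | yes z<mid rewrite glue-< {mid} {f} {g} z<mid = map₂ (λ fz<mid → <-≤-trans fz<mid mid≤hi) (F.range z lo≤z z<mid)
  ... | no z≮mid rewrite glue-≥ {mid} {f} {g} (≮⇒≥ z≮mid) = map₁ (≤-trans lo≤mid) (G.range z (≮⇒≥ z≮mid) z<hi)
  involutive : ∀ z → lo ≤ z → z < hi → h (h z) ≡ z
  involutive z lo≤z z<hi with z <? mid
  ... | yes z<mid rewrite glue-< {mid} {f} {g} z<mid | glue-< {mid} {f} {g} (proj₂ (F.range z lo≤z z<mid))
    = F.involutive z lo≤z z<mid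
  ... | no z≮mid rewrite glue-≥ {mid} {f} {g} (≮⇒≥ z≮mid) | glue-≥ {mid} {f} {g} (proj₁ (G.range z (≮⇒≥ z≮mid) z<hi))
    = G.involutive z (≮⇒≥ z≮mid) z<hi
  noFixed : ∀ z → lo ≤ z → z < hi → h z ≢ z
  noFixed z lo≤z z<hi with z <? mid
  ... | yes z<mid rewrite glue-< {mid} {f} {g} z<mid = F.noFixed z lo≤z z<mid
  ... | no z≮mid rewrite glue-≥ {mid} {f} {g} (≮⇒≥ z≮mid) = G.noFixed z (≮⇒≥ z≮mid) z<hi
  nonCrossing : ∀ a b → lo ≤ a → a < hi → Between b a (h a) → Between (h b) a (h a)
  nonCrossing a b lo≤a a<hi between with a <? mid
  ... | yes a<mid rewrite glue-< {mid} {f} {g} a<mid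
                        | glue-< {mid} {f} {g} (Between-upper a<mid (proj₂ (F.range a lo≤a a<mid)) between)
    = F.nonCrossing a b lo≤a a<mid between
  ... | no a≮mid rewrite glue-≥ {mid} {f} {g} (≮⇒≥ a≮mid)
                       | glue-≥ {mid} {f} {g} (Between-lower (≮⇒≥ a≮mid) (proj₁ (G.range a (≮⇒≥ a≮mid) a<hi)) between)
    = G.nonCrossing a b (≮⇒≥ a≮mid) a<hi between

enclose : ℕ → ℕ → (ℕ → ℕ) → ℕ → ℕ
enclose lo e f z = if z ≡ᵇ lo then e else (if z ≡ᵇ e then lo else f z)

enclose-lo : ∀ lo e f → enclose lo e f lo ≡ e
enclose-lo lo e f rewrite ≡⇒≡ᵇ≡true {lo} refl = refl

enclose-e : ∀ lo e f → lo < e → enclose lo e f e ≡ lo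
enclose-e lo e f lo<e rewrite ≢⇒≡ᵇ≡false {e} {lo} (λ e≡lo → <-irrefl (sym e≡lo) lo<e) | ≡⇒≡ᵇ≡true {e} refl = refl

enclose-inner : ∀ lo e f z → lo < z → z < e → enclose lo e f z ≡ f z
enclose-inner lo e f z lo<z z<e
  rewrite ≢⇒≡ᵇ≡false {z} {lo} (λ z≡lo → <-irrefl (sym z≡lo) lo<z) | ≢⇒≡ᵇ≡false {z} {e} (λ z≡e → <-irrefl z≡e z<e) = refl

endpoint-or-inner : ∀ {lo e z} → lo ≤ z → z < suc e → z ≡ lo ⊎ z ≡ e ⊎ (lo < z × z < e)
endpoint-or-inner lo≤z z<1+e with m≤n⇒m<n∨m≡n lo≤z | m≤n⇒m<n∨m≡n (≤-pred z<1+e)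
... | inj₂ lo≡z | _ = inj₁ (sym lo≡z)
... | inj₁ _ | inj₂ z≡e = inj₂ (inj₁ z≡e)
... | inj₁ lo<z | inj₁ z<e = inj₂ (inj₂ (lo<z , z<e))

enclose-isMatchingOn : ∀ {f lo e} → lo < e → IsMatchingOn f (suc lo) e → IsMatchingOn (enclose lo e f) lo (suc e)
enclose-isMatchingOn {f} {lo} {e} lo<e F = record
  { range = range ; involutive = involutive ; noFixed = noFixed ; nonCrossing = nonCrossing }
  where
  module F = IsMatchingOn F
  h = enclose lo e f
  range : ∀ z → lo ≤ z → z < suc e → lo ≤ h z × h z < suc e
  range z lo≤z z<1+e with endpoint-or-inner lo≤z z<1+e
  ... | inj₁ refl rewrite enclose-lo lo e f = <⇒≤ lo<e , ≤-refl
  ... | inj₂ (inj₁ refl) rewrite enclose-e lo e f lo<e = ≤-refl , s≤s (<⇒≤ lo<e)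
  ... | inj₂ (inj₂ (lo<z , z<e)) rewrite enclose-inner lo e f z lo<z z<e
    = map₂ (λ fz<e → <-trans fz<e (n<1+n e)) (map₁ <⇒≤ (F.range z lo<z z<e))
  involutive : ∀ z → lo ≤ z → z < suc e → h (h z) ≡ z
  involutive z lo≤z z<1+e with endpoint-or-inner lo≤z z<1+e
  ... | inj₁ refl rewrite enclose-lo lo e f = enclose-e lo e f lo<e
  ... | inj₂ (inj₁ refl) rewrite enclose-e lo e f lo<e = enclose-lo lo e f
  ... | inj₂ (inj₂ (lo<z , z<e)) rewrite enclose-inner lo e f z lo<z z<e
                                       | uncurry (enclose-inner lo e f (f z)) (F.range z lo<z z<e)
    = F.involutive z lo<z z<e
  noFixed : ∀ z → lo ≤ z → z < suc e → h z ≢ z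
  noFixed z lo≤z z<1+e with endpoint-or-inner lo≤z z<1+e
  ... | inj₁ refl rewrite enclose-lo lo e f = λ e≡lo → <-irrefl (sym e≡lo) lo<e
  ... | inj₂ (inj₁ refl) rewrite enclose-e lo e f lo<e = λ lo≡e → <-irrefl lo≡e lo<e
  ... | inj₂ (inj₂ (lo<z , z<e)) rewrite enclose-inner lo e f z lo<z z<e = F.noFixed z lo<z z<e
  nonCrossing : ∀ a b → lo ≤ a → a < suc e → Between b a (h a) → Between (h b) a (h a)
  nonCrossing a b lo≤a a<1+e between with endpoint-or-inner lo≤a a<1+e
  nonCrossing a b _ _ between | inj₁ refl rewrite enclose-lo lo e f with between
  ... | inj₁ (lo<b , b<e) rewrite enclose-inner lo e f b lo<b b<e = inj₁ (F.range b lo<b b<e)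
  ... | inj₂ (e<b , b<lo) = ⊥-elim (<-asym lo<e (<-trans e<b b<lo))
  nonCrossing a b _ _ between | inj₂ (inj₁ refl) rewrite enclose-e lo e f lo<e with between
  ... | inj₂ (lo<b , b<e) rewrite enclose-inner lo e f b lo<b b<e = inj₂ (F.range b lo<b b<e)
  ... | inj₁ (e<b , b<lo) = ⊥-elim (<-asym lo<e (<-trans e<b b<lo))
  nonCrossing a b _ _ between | inj₂ (inj₂ (lo<a , a<e)) rewrite enclose-inner lo e f a lo<a a<e
                                                              | enclose-inner lo e f b (Between-lower lo<a (proj₁ (F.range a lo<a a<e)) between)
                                                                                       (Between-upper a<e (proj₂ (F.range a lo<a a<e)) between)
    = F.nonCrossing a b lo<a a<e between

windowCount : (ℕ → ℕ → ℕ) → (ℕ → ℕ) → ℕ → ℕ → ℕ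
windowCount Q f lo len = ℕΣ.∑ len (λ i → Q (lo + i) (f (lo + i)))

windowCount-split : ∀ Q f lo a b → windowCount Q f lo (a + b) ≡ windowCount Q f lo a + windowCount Q f (lo + a) b
windowCount-split Q f lo a b = trans (ℕΣ.∑-split a b _)
  (cong (_+_ (windowCount Q f lo a)) (ℕΣ.∑-cong b (λ i _ → cong (λ t → Q t (f t)) (sym (+-assoc lo a i)))))

windowCount-glue : ∀ Q f g lo a b → windowCount Q (glue (lo + a) f g) lo (a + b) ≡ windowCount Q f lo a + windowCount Q g (lo + a) b
windowCount-glue Q f g lo a b = trans (windowCount-split Q (glue (lo + a) f g) lo a b) (cong₂ _+_
  (ℕΣ.∑-cong a (λ i i<a → cong (Q (lo + i)) (glue-< {lo + a} {f} {g} (+-monoʳ-< lo i<a))))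
  (ℕΣ.∑-cong b (λ i _ → cong (Q (lo + a + i)) (glue-≥ {lo + a} {f} {g} (m≤m+n (lo + a) i)))))

windowCount-enclose : ∀ Q f lo l → windowCount Q (enclose lo (lo + suc l) f) lo (suc (suc l))
                      ≡ Q lo (lo + suc l) + (windowCount Q f (suc lo) l + Q (lo + suc l) lo)
windowCount-enclose Q f lo l = begin
  ℕΣ.∑ (suc l) term + term (suc l)                               ≡⟨ cong (_+ term (suc l)) (ℕΣ.∑-head l term) ⟩
  term 0 + ℕΣ.∑ l (term ∘ suc) + term (suc l)                    ≡⟨ cong₂ (λ u v → u + v + term (suc l)) term-lo (ℕΣ.∑-cong l term-inner) ⟩
  Q lo e + windowCount Q f (suc lo) l + term (suc l)             ≡⟨ cong (_+_ (Q lo e + windowCount Q f (suc lo) l)) term-e ⟩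
  Q lo e + windowCount Q f (suc lo) l + Q e lo                   ≡⟨ +-assoc (Q lo e) (windowCount Q f (suc lo) l) (Q e lo) ⟩
  Q lo e + (windowCount Q f (suc lo) l + Q e lo)                 ∎
  where
  open ≡-Reasoning
  e = lo + suc l
  term : ℕ → ℕ
  term i = Q (lo + i) (enclose lo e f (lo + i))
  lo<e : lo < e
  lo<e = subst (lo <_) (sym (+-suc lo l)) (s≤s (m≤m+n lo l))
  term-lo : term 0 ≡ Q lo e
  term-lo rewrite +-identityʳ lo = cong (Q lo) (enclose-lo lo e f)
  term-inner : ∀ i → i < l → term (suc i) ≡ Q (suc lo + i) (f (suc lo + i))
  term-inner i i<l rewrite +-suc lo i = cong (Q (suc (lo + i)))
    (enclose-inner lo e f (suc (lo + i)) (s≤s (m≤m+n lo i)) (subst (suc (lo + i) <_) (sym (+-suc lo l)) (s≤s (+-monoʳ-< lo i<l))))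
  term-e : term (suc l) ≡ Q e lo
  term-e = cong (Q e) (enclose-e lo e f lo<e)

oddLeftAt : ℕ → ℕ → ℕ
oddLeftAt z y = 𝟙 ((z <ᵇ y) ∧ not (isEvenᵇ z))

windowCount-adjacent : ∀ s k → windowCount oddLeftAt (shift s adjacent) s (k + k) ≡ k * 𝟙 (not (isEvenᵇ s))
windowCount-adjacent s zero = refl
windowCount-adjacent s (suc k) = begin
  windowCount oddLeftAt (shift s adjacent) s (suc k + suc k)  ≡⟨ cong (windowCount oddLeftAt (shift s adjacent) s) (+-suc (suc k) k) ⟩
  ℕΣ.∑ (k + k) term + term (k + k) + term (suc (k + k))      ≡⟨ cong₂ (λ u v → u + v + term (suc (k + k))) (windowCount-adjacent s k) term-even ⟩
  k * odd + odd + term (suc (k + k))                          ≡⟨ cong (_+_ (k * odd + odd)) term-odd ⟩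
  k * odd + odd + 0                                           ≡⟨ collect k odd ⟩
  suc k * odd                                                 ∎
  where
  open ≡-Reasoning
  odd = 𝟙 (not (isEvenᵇ s))
  term : ℕ → ℕ
  term i = oddLeftAt (s + i) (shift s adjacent (s + i))
  collect : ∀ k x → k * x + x + 0 ≡ suc k * x
  collect = ℕSolver.solve-∀
  term-even : term (k + k) ≡ odd
  term-even rewrite shift-+ s adjacent (k + k) | isEvenᵇ-double k | <⇒<ᵇ≡true (+-monoʳ-< s (n<1+n (k + k)))
                  | +-comm s (k + k) | isEvenᵇ-+-double k s = refl
  term-odd : term (suc (k + k)) ≡ 0
  term-odd rewrite shift-+ s adjacent (suc (k + k)) | isEvenᵇ-suc (k + k) | isEvenᵇ-double k
                 | ≥⇒<ᵇ≡false (+-monoʳ-≤ s (n≤1+n (k + k))) = refl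

blockSize : ℕ → ℕ → ℕ
blockSize c k = suc (suc (c + c)) + (k + k)

-- An edge {s, s + 2c + 1} around c adjacent pairs, followed by k adjacent pairs.
block : ℕ → ℕ → ℕ → ℕ → ℕ
block s c k = glue (s + suc (suc (c + c))) (enclose s (s + suc (c + c)) (shift (suc s) adjacent)) (shift (s + suc (suc (c + c))) adjacent)

block-isMatchingOn : ∀ s c k → IsMatchingOn (block s c k) s (s + blockSize c k)
block-isMatchingOn s c k = subst (IsMatchingOn (block s c k) s) (+-assoc s _ (k + k))
  (glue-isMatchingOn (m≤m+n s _) (m≤m+n _ (k + k)) enclosed (shift-isMatchingOn (s + suc (suc (c + c))) (adjacent-isMatchingOn k)))
  where
  inner : IsMatchingOn (shift (suc s) adjacent) (suc s) (s + suc (c + c))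
  inner = subst (IsMatchingOn _ (suc s)) (sym (+-suc s (c + c))) (shift-isMatchingOn (suc s) (adjacent-isMatchingOn c))
  enclosed : IsMatchingOn (enclose s (s + suc (c + c)) (shift (suc s) adjacent)) s (s + suc (suc (c + c)))
  enclosed = subst (IsMatchingOn _ s) (sym (+-suc s (suc (c + c))))
    (enclose-isMatchingOn (subst (_≤ s + suc (c + c)) (+-comm s 1) (+-monoʳ-≤ s (s≤s z≤n))) inner)

windowCount-block : ∀ s c k → windowCount oddLeftAt (block s c k) s (blockSize c k)
                    ≡ 𝟙 (not (isEvenᵇ s)) + (c * 𝟙 (isEvenᵇ s) + k * 𝟙 (not (isEvenᵇ s)))
windowCount-block s c k = begin
  windowCount oddLeftAt (block s c k) s (blockSize c k)
    ≡⟨ windowCount-glue oddLeftAt enclosed trailing s (suc (suc (c + c))) (k + k) ⟩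
  windowCount oddLeftAt enclosed s (suc (suc (c + c))) + windowCount oddLeftAt trailing mid (k + k)
    ≡⟨ cong₂ _+_ (windowCount-enclose oddLeftAt (shift (suc s) adjacent) s (c + c)) (windowCount-adjacent mid k) ⟩
  oddLeftAt s (s + suc (c + c)) + (windowCount oddLeftAt (shift (suc s) adjacent) (suc s) (c + c) + oddLeftAt (s + suc (c + c)) s)
    + k * 𝟙 (not (isEvenᵇ mid))
    ≡⟨ cong₂ (λ u v → u + v + k * 𝟙 (not (isEvenᵇ mid))) opening (cong₂ _+_ (windowCount-adjacent (suc s) c) closing) ⟩
  odd + (c * 𝟙 (not (isEvenᵇ (suc s))) + 0) + k * 𝟙 (not (isEvenᵇ mid))
    ≡⟨ cong₂ (λ u v → odd + (c * 𝟙 u + 0) + k * 𝟙 (not v)) (trans (cong not (isEvenᵇ-suc s)) (not-involutive _)) isEvenᵇ-mid ⟩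
  odd + (c * even + 0) + k * odd
    ≡⟨ rearrange odd (c * even) (k * odd) ⟩
  odd + (c * even + k * odd)
    ∎
  where
  open ≡-Reasoning
  mid = s + suc (suc (c + c))
  enclosed = enclose s (s + suc (c + c)) (shift (suc s) adjacent)
  trailing = shift mid adjacent
  odd = 𝟙 (not (isEvenᵇ s))
  even = 𝟙 (isEvenᵇ s)
  rearrange : ∀ a b d → a + (b + 0) + d ≡ a + (b + d)
  rearrange = ℕSolver.solve-∀
  opening : oddLeftAt s (s + suc (c + c)) ≡ odd
  opening rewrite <⇒<ᵇ≡true (subst (s <_) (sym (+-suc s (c + c))) (s≤s (m≤m+n s (c + c)))) = refl
  closing : oddLeftAt (s + suc (c + c)) s ≡ 0
  closing rewrite ≥⇒<ᵇ≡false (m≤m+n s (suc (c + c))) = refl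
  isEvenᵇ-mid : isEvenᵇ mid ≡ isEvenᵇ s
  isEvenᵇ-mid rewrite +-comm s (suc (suc (c + c))) | isEvenᵇ-suc (suc (c + c + s)) | isEvenᵇ-suc (c + c + s)
    = trans (not-involutive _) (isEvenᵇ-+-double c s)

module TwoBlocks (c₁ k₁ c₂ k₂ : ℕ) where

  L₁ L₂ size : ℕ
  L₁ = blockSize c₁ k₁
  L₂ = blockSize c₂ k₂
  size = suc (suc L₁) + L₂

  first second : ℕ → ℕ
  first = enclose 0 (suc L₁) (block 1 c₁ k₁)
  second = block (suc (suc L₁)) c₂ k₂

  twoBlocks : ℕ → ℕ
  twoBlocks = glue (suc (suc L₁)) first second

  twoBlocks-isMatchingOn : IsMatchingOn twoBlocks 0 size
  twoBlocks-isMatchingOn = glue-isMatchingOn z≤n (m≤m+n _ _) (enclose-isMatchingOn z<s (block-isMatchingOn 1 c₁ k₁))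
                                                             (block-isMatchingOn (suc (suc L₁)) c₂ k₂)

  twoBlocks-0 : twoBlocks 0 ≡ suc L₁
  twoBlocks-0 = trans (glue-< {suc (suc L₁)} {first} {second} z<s) (enclose-lo 0 (suc L₁) (block 1 c₁ k₁))

  twoBlocks-local : ∀ {B} → L₁ ≤ B → L₂ ≤ B → ∀ z → 0 < z → z < size → twoBlocks z ≤ B + z
  twoBlocks-local {B} L₁≤B L₂≤B z 0<z z<size with z <? suc (suc L₁)
  ... | yes z<2+L₁ rewrite glue-< {suc (suc L₁)} {first} {second} z<2+L₁ with endpoint-or-inner {0} {suc L₁} z≤n z<2+L₁
  ...   | inj₁ refl = ⊥-elim (<-irrefl refl 0<z)
  ...   | inj₂ (inj₁ refl) rewrite enclose-e 0 (suc L₁) (block 1 c₁ k₁) z<s = z≤n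
  ...   | inj₂ (inj₂ (0<z′ , z<1+L₁)) rewrite enclose-inner 0 (suc L₁) (block 1 c₁ k₁) z 0<z′ z<1+L₁
    = ≤-trans (≤-pred (proj₂ (IsMatchingOn.range (block-isMatchingOn 1 c₁ k₁) z 0<z′ z<1+L₁))) (≤-trans L₁≤B (m≤m+n B z))
  twoBlocks-local {B} L₁≤B L₂≤B z 0<z z<size | no z≮2+L₁ rewrite glue-≥ {suc (suc L₁)} {first} {second} (≮⇒≥ z≮2+L₁)
    = ≤-trans (<⇒≤ (proj₂ (IsMatchingOn.range (block-isMatchingOn (suc (suc L₁)) c₂ k₂) z (≮⇒≥ z≮2+L₁) z<size)))
              (subst (_≤ B + z) (+-comm L₂ _) (+-mono-≤ L₂≤B (≮⇒≥ z≮2+L₁)))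

  windowCount-twoBlocks : windowCount oddLeftAt twoBlocks 0 size ≡ suc (k₁ + c₂)
  windowCount-twoBlocks = begin
    windowCount oddLeftAt twoBlocks 0 size
      ≡⟨ windowCount-glue oddLeftAt first second 0 (suc (suc L₁)) L₂ ⟩
    windowCount oddLeftAt first 0 (suc (suc L₁)) + windowCount oddLeftAt second (suc (suc L₁)) L₂
      ≡⟨ cong₂ _+_ (windowCount-enclose oddLeftAt (block 1 c₁ k₁) 0 L₁) (windowCount-block (suc (suc L₁)) c₂ k₂) ⟩
    0 + (windowCount oddLeftAt (block 1 c₁ k₁) 1 L₁ + 0) + (𝟙 (not e) + (c₂ * 𝟙 e + k₂ * 𝟙 (not e)))
      ≡⟨ cong₂ (λ u v → 0 + (u + 0) + (𝟙 (not v) + (c₂ * 𝟙 v + k₂ * 𝟙 (not v)))) (windowCount-block 1 c₁ k₁) isEvenᵇ-2+L₁ ⟩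
    0 + (1 + (c₁ * 0 + k₁ * 1) + 0) + (0 + (c₂ * 1 + k₂ * 0))
      ≡⟨ simplify c₁ k₁ c₂ k₂ ⟩
    suc (k₁ + c₂)
      ∎
    where
    open ≡-Reasoning
    e = isEvenᵇ (suc (suc L₁))
    isEvenᵇ-2+L₁ : e ≡ true
    isEvenᵇ-2+L₁ rewrite isEvenᵇ-suc (suc L₁) | isEvenᵇ-suc L₁ | isEvenᵇ-suc (suc (c₁ + c₁ + (k₁ + k₁)))
                       | isEvenᵇ-suc (c₁ + c₁ + (k₁ + k₁)) | isEvenᵇ-+-double c₁ (k₁ + k₁) | isEvenᵇ-double k₁ = refl
    simplify : ∀ c₁ k₁ c₂ k₂ → 0 + (1 + (c₁ * 0 + k₁ * 1) + 0) + (0 + (c₂ * 1 + k₂ * 0)) ≡ suc (k₁ + c₂)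
    simplify = ℕSolver.solve-∀

module TwoBlocksWeight {m h} (m≡h+h : m ≡ h + h) (0<m : 0 < m) (c₁ k₁ c₂ k₂ : ℕ) where
  open TwoBlocks c₁ k₁ c₂ k₂

  module _ (size≡ : size ≡ m + m) (L₁≤m : L₁ ≤ m) (L₂≤m : L₂ ≤ m) where

    matching : IsMatchingOn twoBlocks 0 (m + m)
    matching = subst (IsMatchingOn twoBlocks 0) size≡ twoBlocks-isMatchingOn

    open EvenWeight {h = h} m≡h+h 0<m matching

    private
      0<n : 0 < m + m
      0<n = subst (0 <_) size≡ z<s

      short-away-from-0 : ∀ z → 0 < z → z < m + m → isLong z ≡ false
      short-away-from-0 z 0<z z<n = ≥⇒<ᵇ≡false (twoBlocks-local L₁≤m L₂≤m z 0<z (subst (z <_) (sym size≡) z<n))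

      oddLeft≡ : oddLeft ≡ suc (k₁ + c₂)
      oddLeft≡ = trans (cong (windowCount oddLeftAt twoBlocks 0) (sym size≡)) windowCount-twoBlocks

      evenLong≡ : evenLong ≡ 𝟙 (isLong 0)
      evenLong≡ = trans (∑-only-head (m + m) _ 0<n (λ z 0<z z<n → cong (λ t → 𝟙 (t ∧ isEvenᵇ z)) (short-away-from-0 z 0<z z<n)))
                        (cong 𝟙 (∧-identityʳ (isLong 0)))

      oddLong≡0 : oddLong ≡ 0
      oddLong≡0 = trans (∑-only-head (m + m) _ 0<n (λ z 0<z z<n → cong (λ t → 𝟙 (t ∧ not (isEvenᵇ z))) (short-away-from-0 z 0<z z<n)))
                        (cong 𝟙 (∧-zeroʳ (isLong 0)))

    weight-short : L₁ < m → weight (toNCMatching matching) ≡ + suc (k₁ + c₂)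
    weight-short L₁<m = trans (weight-toNCMatching matching) (trans (weight-balanced balanced) (cong +_ oddLeft≡))
      where
      balanced : evenLong ≡ oddLong
      balanced rewrite evenLong≡ | oddLong≡0 | twoBlocks-0 | ≥⇒<ᵇ≡false (subst (suc L₁ ≤_) (sym (+-identityʳ m)) L₁<m) = refl

    weight-long : m ≤ L₁ → weight (toNCMatching matching) ≡ + suc (k₁ + c₂) ℤ.- + (m ∸ 1)
    weight-long m≤L₁ = trans (weight-toNCMatching matching)
                             (trans (weight-unbalanced unbalanced) (cong (λ t → + t ℤ.- + (m ∸ 1)) oddLeft≡))
      where
      unbalanced : evenLong ≡ suc oddLong
      unbalanced rewrite evenLong≡ | oddLong≡0 | twoBlocks-0 | <⇒<ᵇ≡true (subst (_< suc L₁) (sym (+-identityʳ m)) (s≤s m≤L₁)) = refl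

blocksFor : ∀ P Q a → a ≤ P + Q →
  ∃[ c₁ ] ∃[ k₁ ] ∃[ c₂ ] ∃[ k₂ ] (blockSize c₁ k₁ ≡ suc (suc (P + P)) × blockSize c₂ k₂ ≡ suc (suc (Q + Q)) × k₁ + c₂ ≡ a)
blocksFor P Q a a≤P+Q with a ≤? P
... | yes a≤P = P ∸ a , a , 0 , Q , cong (suc ∘ suc) (double-split a≤P) , refl , +-identityʳ a
  where
  double-split : ∀ {x y} → x ≤ y → y ∸ x + (y ∸ x) + (x + x) ≡ y + y
  double-split {x} {y} x≤y = trans (swap (y ∸ x) x) (cong (λ t → t + t) (m∸n+n≡m x≤y))
    where
    swap : ∀ u v → u + u + (v + v) ≡ u + v + (u + v)
    swap = ℕSolver.solve-∀
... | no a≰P = 0 , P , a ∸ P , Q ∸ (a ∸ P) , refl , cong (suc ∘ suc) (double-split a∸P≤Q) , m+[n∸m]≡n P≤a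
  where
  P≤a = <⇒≤ (≰⇒> a≰P)
  a∸P≤Q = m≤n+o⇒m∸n≤o a P a≤P+Q
  double-split : ∀ {x y} → x ≤ y → x + x + (y ∸ x + (y ∸ x)) ≡ y + y
  double-split {x} {y} x≤y = trans (swap x (y ∸ x)) (cong (λ t → t + t) (m+[n∸m]≡n x≤y))
    where
    swap : ∀ u v → u + u + (v + v) ≡ u + v + (u + v)
    swap = ℕSolver.solve-∀

module Realization (g : ℕ) where

  h m : ℕ
  h = suc (suc g)
  m = h + h

  private
    0<m : 0 < m
    0<m = z<s

    m≡ : m ≡ suc (suc (suc (suc (g + g))))
    m≡ = cong (suc ∘ suc) (trans (+-suc g (suc g)) (cong suc (+-suc g g)))

  realize-positive : ∀ j → j ≤ suc (g + g) → ∃[ M ] (weight {m + m} M ≡ + suc j)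
  realize-positive j j≤ with blocksFor g (suc g) j (subst (j ≤_) (sym (+-suc g g)) j≤)
  ... | c₁ , k₁ , c₂ , k₂ , L₁≡ , L₂≡ , k₁+c₂≡j
    = toNCMatching (matching size≡ L₁≤m L₂≤m)
    , trans (weight-short size≡ L₁≤m L₂≤m L₁<m) (cong (+_ ∘ suc) k₁+c₂≡j)
    where
    open TwoBlocks c₁ k₁ c₂ k₂ using (L₁; L₂; size)
    open TwoBlocksWeight {m} {h} refl 0<m c₁ k₁ c₂ k₂
    L₂≡m : L₂ ≡ m
    L₂≡m = trans L₂≡ (trans (cong (suc ∘ suc ∘ suc) (+-suc g g)) (sym m≡))
    size≡ : size ≡ m + m
    size≡ = trans (cong₂ (λ u v → suc (suc u) + v) L₁≡ L₂≡m) (cong (_+ m) (sym m≡))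
    L₁<m : L₁ < m
    L₁<m = subst₂ _<_ (sym L₁≡) (sym m≡) (<-trans (n<1+n _) (n<1+n _))
    L₁≤m : L₁ ≤ m
    L₁≤m = <⇒≤ L₁<m
    L₂≤m : L₂ ≤ m
    L₂≤m = ≤-reflexive L₂≡m

  realize-negative : ∀ j → j ≤ suc (g + g) → ∃[ M ] (weight {m + m} M ≡ - (+ suc j))
  realize-negative j j≤ with blocksFor (suc g) g a (m∸n≤m (suc (g + g)) j)
    where a = suc (g + g) ∸ j
  ... | c₁ , k₁ , c₂ , k₂ , L₁≡ , L₂≡ , k₁+c₂≡a
    = toNCMatching (matching size≡ L₁≤m L₂≤m)
    , trans (weight-long size≡ L₁≤m L₂≤m m≤L₁) (trans (cong (λ t → + suc t ℤ.- + (m ∸ 1)) k₁+c₂≡a) weight≡)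
    where
    open TwoBlocks c₁ k₁ c₂ k₂ using (L₁; L₂; size)
    open TwoBlocksWeight {m} {h} refl 0<m c₁ k₁ c₂ k₂
    a = suc (g + g) ∸ j
    L₁≡m : L₁ ≡ m
    L₁≡m = trans L₁≡ (trans (cong (suc ∘ suc ∘ suc) (+-suc g g)) (sym m≡))
    size≡ : size ≡ m + m
    size≡ = trans (cong₂ (λ u v → suc (suc u) + v) L₁≡m L₂≡)
                  (trans (sym (trans (+-suc m _) (cong suc (+-suc m _)))) (cong (_+_ m) (sym m≡)))
    L₁≤m : L₁ ≤ m
    L₁≤m = ≤-reflexive L₁≡m
    m≤L₁ : m ≤ L₁
    m≤L₁ = ≤-reflexive (sym L₁≡m)
    L₂≤m : L₂ ≤ m
    L₂≤m = subst₂ _≤_ (sym L₂≡) (sym m≡) (≤-trans (n≤1+n _) (n≤1+n _))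
    m-1≡ : m ∸ 1 ≡ suc a + suc j
    m-1≡ = trans (cong (_∸ 1) m≡) (trans (cong (suc ∘ suc) (sym (m∸n+n≡m j≤))) (cong suc (sym (+-suc a j))))
    weight≡ : + suc a ℤ.- + (m ∸ 1) ≡ - (+ suc j)
    weight≡ = begin
      + suc a ℤ.- + (m ∸ 1)                 ≡⟨ cong (λ t → + suc a ℤ.- + t) m-1≡ ⟩
      + suc a ℤ.- + (suc a + suc j)         ≡⟨ cong (λ t → + suc a ℤ.- t) (ℤₚ.pos-+ (suc a) (suc j)) ⟩
      + suc a ℤ.- (+ suc a ℤ.+ + suc j)     ≡⟨ cancel (+ suc a) (+ suc j) ⟩
      - (+ suc j)                           ∎
      where
      open ≡-Reasoning
      cancel : ∀ x y → x ℤ.- (x ℤ.+ y) ≡ - y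
      cancel = ℤSolver.solve-∀

[2+g]+[2+g]∸2 : ∀ g → suc (suc g) + suc (suc g) ∸ 2 ≡ suc (suc (g + g))
[2+g]+[2+g]∸2 g = trans (+-suc g (suc g)) (cong suc (+-suc g g))

realize : ∀ q (c : ℤ) → - (+ (q + q ∸ 2)) ℤ.≤ c → c ℤ.≤ + (q + q ∸ 2) → ∃[ M ] (weight {q + q + (q + q)} M ≡ c)
realize q (+ zero) _ _ = toNCMatching (adjacent-isMatchingOn (q + q)) , weight-adjacent (q + q)
realize (suc (suc g)) (+ suc j) _ 1+j≤ =
  Realization.realize-positive g j (≤-pred (subst (suc j ≤_) ([2+g]+[2+g]∸2 g) (ℤₚ.drop‿+≤+ 1+j≤)))
realize (suc (suc g)) ℤ.-[1+ j ] ≤-[1+j] _ =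
  Realization.realize-negative g j (≤-pred (subst (suc j ≤_) ([2+g]+[2+g]∸2 g)
    (ℤₚ.drop‿+≤+ (subst (+ suc j ℤ.≤_) (ℤₚ.neg-involutive _) (ℤₚ.neg-mono-≤ ≤-[1+j])))))
realize zero (+ suc j) _ (ℤ.+≤+ ())
realize (suc zero) (+ suc j) _ (ℤ.+≤+ ())
realize zero ℤ.-[1+ j ] () _
realize (suc zero) ℤ.-[1+ j ] () _

lemma12 : (m : ℕ) → 2 ≤ m → 2 ∣ m →
    ((M : NCMatching (2 Data.Nat.* m)) →
       (- (+ (m ∸ 2)) ℤ.≤ weight M) × (weight M ℤ.≤ + (m ∸ 2)))
    × ((c : ℤ) → - (+ (m ∸ 2)) ℤ.≤ c → c ℤ.≤ + (m ∸ 2) →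
       ∃[ M ] (weight {2 Data.Nat.* m} M ≡ c))
lemma12 m 2≤m (divides q m≡q*2) rewrite cong (_+_ m) (+-identityʳ m) = bounds , realize′
  where
  m≡q+q : m ≡ q + q
  m≡q+q = trans m≡q*2 (trans (*-comm q 2) (cong (_+_ q) (+-identityʳ q)))
  0<m : 0 < m
  0<m = <-trans z<s 2≤m
  bounds : (M : NCMatching (m + m)) → (- (+ (m ∸ 2)) ℤ.≤ weight M) × (weight M ℤ.≤ + (m ∸ 2))
  bounds M rewrite weight-partnerℕ M = EvenWeight.weight-bounds {h = q} m≡q+q 0<m (isMatchingOn-partnerℕ M)
  realize′ : (c : ℤ) → - (+ (m ∸ 2)) ℤ.≤ c → c ℤ.≤ + (m ∸ 2) → ∃[ M ] (weight {m + m} M ≡ c)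
  realize′ rewrite m≡q+q = realize q
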